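{- The series $\sum_{k=0}^{\infty}\frac{(-3)^k}{2k+1}$ converges in the field $\mathbb{Q}_3$ of $3$-adic numbers and its sum equals $0$.
   Context: $\mathbb{Q}_3$ denotes the field of $3$-adic numbers with the $3$-adic absolute value. -}

module Defs where

open import Data.Nat as ℕ using (ℕ; zero; suc; _≥_; NonZero)
open import Data.Nat.DivMod using (_%_; _/_)
open import Data.Nat.Properties using (m^n≢0)
open import Data.Integer as ℤ using (ℤ; +_; -[1+_])
open import Data.Rational as ℚ using (ℚ; 0ℚ; ↥_; ↧ₙ_)
open import Data.Product using (∃)

-- 3-adic valuation of a natural number, computed with fuel
-- (fuel n suffices for input n; by convention v₃ 0 = 0, never used for 0).
v₃-go : ℕ → ℕ → ℕ
v₃-go zero    _ = 0
v₃-go (suc f) zero = 0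
v₃-go (suc f) n@(suc _) with n % 3
... | zero  = suc (v₃-go f (n / 3))
... | suc _ = 0

v₃ℕ : ℕ → ℕ
v₃ℕ n = v₃-go n n

∣_∣₃ : ℚ → ℚ
∣ x ∣₃ with ↥ x
... | + zero = 0ℚ
... | + (suc k) = (+ (3 ℕ.^ v₃ℕ (↧ₙ x))) ℚ./ (3 ℕ.^ v₃ℕ (suc k)) where
  instance _ = m^n≢0 3 (v₃ℕ (suc k))
... | -[1+ k ] = (+ (3 ℕ.^ v₃ℕ (↧ₙ x))) ℚ./ (3 ℕ.^ v₃ℕ (suc k)) where
  instance _ = m^n≢0 3 (v₃ℕ (suc k))

term : ℕ → ℚ
term k = (ℤ.- (+ 3)) ℤ.^ k ℚ./ suc (2 ℕ.* k)

S : ℕ → ℚ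
S zero    = term 0
S (suc n) = S n ℚ.+ term (suc n)

ConvergesTo₃ : (ℕ → ℚ) → ℚ → Set
ConvergesTo₃ a L =
  ∀ (ε : ℚ) → 0ℚ ℚ.< ε → ∃ λ N → ∀ n → n ≥ N → ∣ a n ℚ.- L ∣₃ ℚ.< ε

-- Write logSum p N = Σ_{n=1}^{N} pⁿ/n for the truncated series of -log (1 - p), and let
-- g = 1 - (1 - X)³ = 3X - 3X² + X³. Formally log (1 - g) = 3 log (1 - X), so the polynomial
-- E N = 3 logSum X N - logSum g N is divisible by X^(N+1); this is proved with the formal
-- derivative, from (1 - p) · ∂ (logSum p N) = ∂ p · (1 - pᴺ).
-- Evaluate at √-3, where (1 - √-3)³ = -8 makes g (√-3) = 9 rational. For N = 2n + 1 the
-- imaginary part of E N (√-3) is then 3 · S n, while the divisibility by X^(N+1) exhibits it as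
-- (√-3)^(2n+2) = (-3)^(n+1) times the imaginary part of a polynomial value. After scaling by
-- 3^K ≥ N that polynomial has 3-integral coefficients, so 3^(n-K) divides S n in ℤ₍₃₎.
-- Since K can be taken about log₃ n, ∣ S n ∣₃ tends to 0.
module Submission where

open import Defs
open import Data.Rational using (0ℚ)
open import Data.Nat as ℕ using (ℕ; zero; suc; NonZero; _^_)
import Data.Nat.Properties as ℕP
open import Data.Integer as ℤ using (ℤ; +_)
import Data.Integer.Properties as ℤP
open import Data.Rational as ℚ using (ℚ; 1ℚ)
import Data.Rational.Properties as ℚP
import Data.Rational.Unnormalised as ℚᵘ
import Data.Rational.Unnormalised.Properties as ℚᵘP
import Data.Rational.Solver as ℚ-Solver
import Data.Nat.Solver as ℕ-Solver
open import Data.List using (List; []; _∷_; drop)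
open import Data.Product using (_×_; _,_; proj₁; proj₂)
open import Relation.Binary.PropositionalEquality

module Fractions where

  open import Data.Rational using (_/_; _+_; _*_)

  toℚᵘ-/ : ∀ i n .{{_ : NonZero n}} → ℚ.toℚᵘ (i / n) ℚᵘ.≃ (i ℚᵘ./ n)
  toℚᵘ-/ i (suc d) = ℚP.toℚᵘ-fromℚᵘ (ℚᵘ.mkℚᵘ i d)

  /-*-/ : ∀ i j a b .{{_ : NonZero a}} .{{_ : NonZero b}} →
          (i / a) * (j / b) ≡ ((i ℤ.* j) / (a ℕ.* b)) {{ℕP.m*n≢0 a b}}
  /-*-/ i j a@(suc _) b@(suc _) = ℚP.toℚᵘ-injective (begin
    ℚ.toℚᵘ ((i / a) * (j / b))       ≈⟨ ℚP.toℚᵘ-homo-* (i / a) (j / b) ⟩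
    ℚ.toℚᵘ (i / a) ℚᵘ.* ℚ.toℚᵘ (j / b) ≈⟨ ℚᵘP.*-cong (toℚᵘ-/ i a) (toℚᵘ-/ j b) ⟩
    (i ℚᵘ./ a) ℚᵘ.* (j ℚᵘ./ b)         ≈⟨ ℚᵘP.≃-sym (toℚᵘ-/ (i ℤ.* j) (a ℕ.* b)) ⟩
    ℚ.toℚᵘ ((i ℤ.* j) / (a ℕ.* b))     ∎)
    where open ℚᵘP.≃-Reasoning

  /-+-/ : ∀ i j a b .{{_ : NonZero a}} .{{_ : NonZero b}} →
          (i / a) + (j / b) ≡ ((i ℤ.* + b ℤ.+ j ℤ.* + a) / (a ℕ.* b)) {{ℕP.m*n≢0 a b}}
  /-+-/ i j a@(suc _) b@(suc _) = ℚP.toℚᵘ-injective (begin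
    ℚ.toℚᵘ ((i / a) + (j / b))       ≈⟨ ℚP.toℚᵘ-homo-+ (i / a) (j / b) ⟩
    ℚ.toℚᵘ (i / a) ℚᵘ.+ ℚ.toℚᵘ (j / b) ≈⟨ ℚᵘP.+-cong (toℚᵘ-/ i a) (toℚᵘ-/ j b) ⟩
    (i ℚᵘ./ a) ℚᵘ.+ (j ℚᵘ./ b)         ≈⟨ ℚᵘP.≃-sym (toℚᵘ-/ (i ℤ.* + b ℤ.+ j ℤ.* + a) (a ℕ.* b)) ⟩
    ℚ.toℚᵘ ((i ℤ.* + b ℤ.+ j ℤ.* + a) / (a ℕ.* b)) ∎)
    where open ℚᵘP.≃-Reasoning

  *≡*⇒/≡/ : ∀ i j a b .{{_ : NonZero a}} .{{_ : NonZero b}} →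
            i ℤ.* + b ≡ j ℤ.* + a → i / a ≡ j / b
  *≡*⇒/≡/ i j a@(suc _) b@(suc _) eq = ℚP.toℚᵘ-injective
    (ℚᵘP.≃-trans (toℚᵘ-/ i a) (ℚᵘP.≃-trans (ℚᵘ.*≡* eq) (ℚᵘP.≃-sym (toℚᵘ-/ j b))))

  fromℤ : ℤ → ℚ
  fromℤ z = z / 1

  fromℕ : ℕ → ℚ
  fromℕ n = fromℤ (+ n)

  three : ℚ
  three = fromℕ 3

  fromℤ-+ : ∀ a b → fromℤ (a ℤ.+ b) ≡ fromℤ a + fromℤ b
  fromℤ-+ a b = sym (trans (/-+-/ a b 1 1)
    (cong₂ (λ x y → (x ℤ.+ y) / 1) (ℤP.*-identityʳ a) (ℤP.*-identityʳ b)))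

  fromℤ-* : ∀ a b → fromℤ (a ℤ.* b) ≡ fromℤ a * fromℤ b
  fromℤ-* a b = sym (/-*-/ a b 1 1)

  fromℕ-* : ∀ m n → fromℕ (m ℕ.* n) ≡ fromℕ m * fromℕ n
  fromℕ-* m n = trans (cong fromℤ (ℤP.pos-* m n)) (fromℤ-* (+ m) (+ n))

  1/[1+_] : ℕ → ℚ
  1/[1+ m ] = + 1 / suc m

  fromℤ*1/[1+] : ∀ i m → fromℤ i * 1/[1+ m ] ≡ i / suc m
  fromℤ*1/[1+] i m = trans (/-*-/ i (+ 1) 1 (suc m)) (ℚP./-cong (ℤP.*-identityʳ i) (ℕP.*-identityˡ (suc m)))

  [1+]*1/[1+] : ∀ m → fromℕ (suc m) * 1/[1+ m ] ≡ 1ℚ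
  [1+]*1/[1+] m = trans (fromℤ*1/[1+] (+ suc m) m) (*≡*⇒/≡/ (+ suc m) (+ 1) (suc m) 1 (ℤP.*-comm (+ suc m) (+ 1)))

module Polynomials where

  open import Data.Rational using (0ℚ; _+_; _*_; -_; _-_)
  open import Relation.Binary.Bundles using (Setoid)
  import Relation.Binary.Reasoning.Setoid as SetoidReasoning
  open Fractions using (fromℕ; 1/[1+_]; [1+]*1/[1+])
  open ℚ-Solver.+-*-Solver

  Poly : Set
  Poly = List ℚ

  coeff : Poly → ℕ → ℚ
  coeff []      _       = 0ℚ
  coeff (a ∷ p) zero    = a
  coeff (a ∷ p) (suc j) = coeff p j

  infix 4 _≈_
  record _≈_ (p q : Poly) : Set where
    constructor coeffwise
    field at : ∀ j → coeff p j ≡ coeff q j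
  open _≈_ public

  ≈-refl : ∀ {p} → p ≈ p
  ≈-refl = coeffwise λ _ → refl

  ≈-sym : ∀ {p q} → p ≈ q → q ≈ p
  ≈-sym e = coeffwise λ j → sym (at e j)

  ≈-trans : ∀ {p q r} → p ≈ q → q ≈ r → p ≈ r
  ≈-trans e f = coeffwise λ j → trans (at e j) (at f j)

  ≈-setoid : Setoid _ _
  ≈-setoid = record
    { Carrier = Poly ; _≈_ = _≈_
    ; isEquivalence = record { refl = ≈-refl ; sym = ≈-sym ; trans = ≈-trans } }

  module ≈-Reasoning = SetoidReasoning ≈-setoid

  infixl 6 _⊕_ _⊖_
  infixr 7 _·_
  infixl 7 _⊗_

  _⊕_ : Poly → Poly → Poly
  []      ⊕ q       = q
  (a ∷ p) ⊕ []      = a ∷ p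
  (a ∷ p) ⊕ (b ∷ q) = (a + b) ∷ (p ⊕ q)

  _·_ : ℚ → Poly → Poly
  c · []      = []
  c · (a ∷ p) = (c * a) ∷ (c · p)

  ⊖_ : Poly → Poly
  ⊖ p = (- 1ℚ) · p

  _⊖_ : Poly → Poly → Poly
  p ⊖ q = p ⊕ ⊖ q

  shift : Poly → Poly
  shift p = 0ℚ ∷ p

  _⊗_ : Poly → Poly → Poly
  []      ⊗ q = []
  (a ∷ p) ⊗ q = a · q ⊕ shift (p ⊗ q)

  ∂ : Poly → Poly
  ∂ []      = []
  ∂ (a ∷ p) = p ⊕ shift (∂ p)

  coeff-⊕ : ∀ p q j → coeff (p ⊕ q) j ≡ coeff p j + coeff q j
  coeff-⊕ []      q       j       = sym (ℚP.+-identityˡ _)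
  coeff-⊕ (a ∷ p) []      j       = sym (ℚP.+-identityʳ _)
  coeff-⊕ (a ∷ p) (b ∷ q) zero    = refl
  coeff-⊕ (a ∷ p) (b ∷ q) (suc j) = coeff-⊕ p q j

  coeff-· : ∀ c p j → coeff (c · p) j ≡ c * coeff p j
  coeff-· c []      j       = sym (ℚP.*-zeroʳ c)
  coeff-· c (a ∷ p) zero    = refl
  coeff-· c (a ∷ p) (suc j) = coeff-· c p j

  coeff-⊖ : ∀ p q j → coeff (p ⊖ q) j ≡ coeff p j - coeff q j
  coeff-⊖ p q j = begin
    coeff (p ⊖ q) j               ≡⟨ coeff-⊕ p (⊖ q) j ⟩
    coeff p j + coeff (⊖ q) j     ≡⟨ cong (λ x → coeff p j + x) (coeff-· (- 1ℚ) q j) ⟩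
    coeff p j + - 1ℚ * coeff q j  ≡⟨ solve 2 (λ x y → x :+ (:- con 1ℚ) :* y := x :- y) refl (coeff p j) (coeff q j) ⟩
    coeff p j - coeff q j         ∎
    where open ≡-Reasoning

  coeff-∂ : ∀ p j → coeff (∂ p) j ≡ fromℕ (suc j) * coeff p (suc j)
  coeff-∂ []      j       = sym (ℚP.*-zeroʳ (fromℕ (suc j)))
  coeff-∂ (a ∷ p) zero    = trans (coeff-⊕ p (shift (∂ p)) 0)
    (trans (ℚP.+-identityʳ (coeff p 0)) (sym (ℚP.*-identityˡ _)))
  coeff-∂ (a ∷ p) (suc j) = begin
    coeff (p ⊕ shift (∂ p)) (suc j)                 ≡⟨ coeff-⊕ p (shift (∂ p)) (suc j) ⟩
    coeff p (suc j) + coeff (∂ p) j                 ≡⟨ cong (λ x → coeff p (suc j) + x) (coeff-∂ p j) ⟩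
    coeff p (suc j) + fromℕ (suc j) * coeff p (suc j)
      ≡⟨ solve 2 (λ x n → x :+ n :* x := (con 1ℚ :+ n) :* x) refl (coeff p (suc j)) (fromℕ (suc j)) ⟩
    (1ℚ + fromℕ (suc j)) * coeff p (suc j)          ≡⟨ cong (_* coeff p (suc j)) (sym (Fractions.fromℤ-+ (+ 1) (+ suc j))) ⟩
    fromℕ (suc (suc j)) * coeff p (suc j)           ∎
    where open ≡-Reasoning

  ⊕-cong : ∀ {p p' q q'} → p ≈ p' → q ≈ q' → p ⊕ q ≈ p' ⊕ q'
  ⊕-cong {p} {p'} {q} {q'} e f = coeffwise λ j →
    trans (coeff-⊕ p q j) (trans (cong₂ _+_ (at e j) (at f j)) (sym (coeff-⊕ p' q' j)))

  ⊕-congˡ : ∀ {p p'} q → p ≈ p' → p ⊕ q ≈ p' ⊕ q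
  ⊕-congˡ q e = ⊕-cong e ≈-refl

  ⊕-congʳ : ∀ p {q q'} → q ≈ q' → p ⊕ q ≈ p ⊕ q'
  ⊕-congʳ p e = ⊕-cong ≈-refl e

  ·-cong : ∀ {c c' p p'} → c ≡ c' → p ≈ p' → c · p ≈ c' · p'
  ·-cong {c} {_} {p} {p'} refl f = coeffwise λ j →
    trans (coeff-· c p j) (trans (cong (c *_) (at f j)) (sym (coeff-· c p' j)))

  ·-congʳ : ∀ c {p p'} → p ≈ p' → c · p ≈ c · p'
  ·-congʳ c = ·-cong refl

  ⊖-cong : ∀ {p p' q q'} → p ≈ p' → q ≈ q' → p ⊖ q ≈ p' ⊖ q'
  ⊖-cong e f = ⊕-cong e (·-congʳ (- 1ℚ) f)

  shift-cong : ∀ {p p'} → p ≈ p' → shift p ≈ shift p'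
  shift-cong e = coeffwise λ { zero → refl ; (suc j) → at e j }

  ∷-≈-tail : ∀ {a b p q} → a ∷ p ≈ b ∷ q → p ≈ q
  ∷-≈-tail e = coeffwise λ j → at e (suc j)

  ∷-≈[]-tail : ∀ {a p} → a ∷ p ≈ [] → p ≈ []
  ∷-≈[]-tail e = coeffwise λ j → at e (suc j)

  ⊕-identityʳ : ∀ p → p ⊕ [] ≈ p
  ⊕-identityʳ p = coeffwise λ j → trans (coeff-⊕ p [] j) (ℚP.+-identityʳ _)

  ⊕-interchange : ∀ p q r s → (p ⊕ q) ⊕ (r ⊕ s) ≈ (p ⊕ r) ⊕ (q ⊕ s)
  ⊕-interchange p q r s = coeffwise λ j → begin
    coeff ((p ⊕ q) ⊕ (r ⊕ s)) j
      ≡⟨ trans (coeff-⊕ (p ⊕ q) (r ⊕ s) j) (cong₂ _+_ (coeff-⊕ p q j) (coeff-⊕ r s j)) ⟩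
    (coeff p j + coeff q j) + (coeff r j + coeff s j)
      ≡⟨ solve 4 (λ w x y z → (w :+ x) :+ (y :+ z) := (w :+ y) :+ (x :+ z)) refl
           (coeff p j) (coeff q j) (coeff r j) (coeff s j) ⟩
    (coeff p j + coeff r j) + (coeff q j + coeff s j)
      ≡⟨ sym (trans (coeff-⊕ (p ⊕ r) (q ⊕ s) j) (cong₂ _+_ (coeff-⊕ p r j) (coeff-⊕ q s j))) ⟩
    coeff ((p ⊕ r) ⊕ (q ⊕ s)) j ∎
    where open ≡-Reasoning

  ·-distribˡ : ∀ c p q → c · (p ⊕ q) ≈ c · p ⊕ c · q
  ·-distribˡ c p q = coeffwise λ j → begin
    coeff (c · (p ⊕ q)) j                ≡⟨ trans (coeff-· c (p ⊕ q) j) (cong (c *_) (coeff-⊕ p q j)) ⟩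
    c * (coeff p j + coeff q j)          ≡⟨ ℚP.*-distribˡ-+ c _ _ ⟩
    c * coeff p j + c * coeff q j        ≡⟨ sym (cong₂ _+_ (coeff-· c p j) (coeff-· c q j)) ⟩
    coeff (c · p) j + coeff (c · q) j    ≡⟨ sym (coeff-⊕ (c · p) (c · q) j) ⟩
    coeff (c · p ⊕ c · q) j              ∎
    where open ≡-Reasoning

  ·-distribʳ : ∀ c d p → (c + d) · p ≈ c · p ⊕ d · p
  ·-distribʳ c d p = coeffwise λ j → begin
    coeff ((c + d) · p) j                ≡⟨ coeff-· (c + d) p j ⟩
    (c + d) * coeff p j                  ≡⟨ ℚP.*-distribʳ-+ (coeff p j) c d ⟩
    c * coeff p j + d * coeff p j        ≡⟨ sym (cong₂ _+_ (coeff-· c p j) (coeff-· d p j)) ⟩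
    coeff (c · p) j + coeff (d · p) j    ≡⟨ sym (coeff-⊕ (c · p) (d · p) j) ⟩
    coeff (c · p ⊕ d · p) j              ∎
    where open ≡-Reasoning

  ·-assoc : ∀ c d p → c · (d · p) ≈ (c * d) · p
  ·-assoc c d p = coeffwise λ j → trans (coeff-· c (d · p) j)
    (trans (cong (c *_) (coeff-· d p j)) (trans (sym (ℚP.*-assoc c d _)) (sym (coeff-· (c * d) p j))))

  ·-comm : ∀ c d p → c · (d · p) ≈ d · (c · p)
  ·-comm c d p = ≈-trans (·-assoc c d p) (≈-trans (·-cong (ℚP.*-comm c d) ≈-refl) (≈-sym (·-assoc d c p)))

  ·-identityˡ : ∀ p → 1ℚ · p ≈ p
  ·-identityˡ p = coeffwise λ j → trans (coeff-· 1ℚ p j) (ℚP.*-identityˡ _)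

  ·-zeroˡ : ∀ p → 0ℚ · p ≈ []
  ·-zeroˡ p = coeffwise λ j → trans (coeff-· 0ℚ p j) (ℚP.*-zeroˡ (coeff p j))

  ·-shift : ∀ c p → c · shift p ≈ shift (c · p)
  ·-shift c p = coeffwise λ { zero → ℚP.*-zeroʳ c ; (suc j) → refl }

  shift-⊕ : ∀ p q → shift (p ⊕ q) ≈ shift p ⊕ shift q
  shift-⊕ p q = coeffwise λ { zero → refl ; (suc j) → refl }

  shift-[] : shift [] ≈ []
  shift-[] = coeffwise λ { zero → refl ; (suc j) → refl }

  ·-distrib-⊖ : ∀ c p q → c · (p ⊖ q) ≈ c · p ⊖ c · q
  ·-distrib-⊖ c p q = ≈-trans (·-distribˡ c p (⊖ q)) (⊕-congʳ (c · p) (·-comm c (- 1ℚ) q))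

  ⊖-self : ∀ p → p ⊖ p ≈ []
  ⊖-self p = coeffwise λ j → trans (coeff-⊖ p p j) (ℚP.+-inverseʳ (coeff p j))

  ⊗-zeroˡ : ∀ p q → p ≈ [] → p ⊗ q ≈ []
  ⊗-zeroˡ []      q e = ≈-refl
  ⊗-zeroˡ (a ∷ p) q e = begin
    a · q ⊕ shift (p ⊗ q) ≈⟨ ⊕-cong (·-cong (at e 0) ≈-refl) (shift-cong (⊗-zeroˡ p q (∷-≈[]-tail e))) ⟩
    0ℚ · q ⊕ shift []     ≈⟨ ⊕-cong (·-zeroˡ q) shift-[] ⟩
    []                    ∎
    where open ≈-Reasoning

  ⊗-zeroʳ : ∀ p → p ⊗ [] ≈ []
  ⊗-zeroʳ []      = ≈-refl
  ⊗-zeroʳ (a ∷ p) = ≈-trans (shift-cong (⊗-zeroʳ p)) shift-[]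

  ⊗-congˡ : ∀ {p p'} q → p ≈ p' → p ⊗ q ≈ p' ⊗ q
  ⊗-congˡ {[]}    {p'}     q e = ≈-sym (⊗-zeroˡ p' q (≈-sym e))
  ⊗-congˡ {a ∷ p} {[]}     q e = ⊗-zeroˡ (a ∷ p) q e
  ⊗-congˡ {a ∷ p} {b ∷ p'} q e = ⊕-cong (·-cong (at e 0) ≈-refl) (shift-cong (⊗-congˡ q (∷-≈-tail e)))

  ⊗-congʳ : ∀ p {q q'} → q ≈ q' → p ⊗ q ≈ p ⊗ q'
  ⊗-congʳ []      e = ≈-refl
  ⊗-congʳ (a ∷ p) e = ⊕-cong (·-congʳ a e) (shift-cong (⊗-congʳ p e))

  ⊗-shiftˡ : ∀ p q → shift p ⊗ q ≈ shift (p ⊗ q)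
  ⊗-shiftˡ p q = ⊕-congˡ (shift (p ⊗ q)) (·-zeroˡ q)

  ⊗-shiftʳ : ∀ p q → p ⊗ shift q ≈ shift (p ⊗ q)
  ⊗-shiftʳ []      q = ≈-sym shift-[]
  ⊗-shiftʳ (a ∷ p) q = begin
    a · shift q ⊕ shift (p ⊗ shift q)    ≈⟨ ⊕-cong (·-shift a q) (shift-cong (⊗-shiftʳ p q)) ⟩
    shift (a · q) ⊕ shift (shift (p ⊗ q)) ≈⟨ ≈-sym (shift-⊕ (a · q) (shift (p ⊗ q))) ⟩
    shift (a · q ⊕ shift (p ⊗ q))        ∎
    where open ≈-Reasoning

  ⊗-·ˡ : ∀ c p q → (c · p) ⊗ q ≈ c · (p ⊗ q)
  ⊗-·ˡ c []      q = ≈-refl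
  ⊗-·ˡ c (a ∷ p) q = begin
    (c * a) · q ⊕ shift ((c · p) ⊗ q)    ≈⟨ ⊕-cong (≈-sym (·-assoc c a q)) (shift-cong (⊗-·ˡ c p q)) ⟩
    c · (a · q) ⊕ shift (c · (p ⊗ q))    ≈⟨ ⊕-congʳ (c · (a · q)) (≈-sym (·-shift c (p ⊗ q))) ⟩
    c · (a · q) ⊕ c · shift (p ⊗ q)      ≈⟨ ≈-sym (·-distribˡ c (a · q) (shift (p ⊗ q))) ⟩
    c · (a · q ⊕ shift (p ⊗ q))          ∎
    where open ≈-Reasoning

  ⊗-·ʳ : ∀ c p q → p ⊗ (c · q) ≈ c · (p ⊗ q)
  ⊗-·ʳ c []      q = ≈-refl
  ⊗-·ʳ c (a ∷ p) q = begin
    a · (c · q) ⊕ shift (p ⊗ (c · q))    ≈⟨ ⊕-cong (·-comm a c q) (shift-cong (⊗-·ʳ c p q)) ⟩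
    c · (a · q) ⊕ shift (c · (p ⊗ q))    ≈⟨ ⊕-congʳ (c · (a · q)) (≈-sym (·-shift c (p ⊗ q))) ⟩
    c · (a · q) ⊕ c · shift (p ⊗ q)      ≈⟨ ≈-sym (·-distribˡ c (a · q) (shift (p ⊗ q))) ⟩
    c · (a · q ⊕ shift (p ⊗ q))          ∎
    where open ≈-Reasoning

  ⊗-distribʳ : ∀ p q r → (p ⊕ q) ⊗ r ≈ p ⊗ r ⊕ q ⊗ r
  ⊗-distribʳ []      q       r = ≈-refl
  ⊗-distribʳ (a ∷ p) []      r = ≈-sym (⊕-identityʳ _)
  ⊗-distribʳ (a ∷ p) (b ∷ q) r = begin
    (a + b) · r ⊕ shift ((p ⊕ q) ⊗ r)
      ≈⟨ ⊕-cong (·-distribʳ a b r) (≈-trans (shift-cong (⊗-distribʳ p q r)) (shift-⊕ (p ⊗ r) (q ⊗ r))) ⟩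
    (a · r ⊕ b · r) ⊕ (shift (p ⊗ r) ⊕ shift (q ⊗ r))
      ≈⟨ ⊕-interchange (a · r) (b · r) (shift (p ⊗ r)) (shift (q ⊗ r)) ⟩
    (a · r ⊕ shift (p ⊗ r)) ⊕ (b · r ⊕ shift (q ⊗ r)) ∎
    where open ≈-Reasoning

  ⊗-distribˡ : ∀ p q r → p ⊗ (q ⊕ r) ≈ p ⊗ q ⊕ p ⊗ r
  ⊗-distribˡ []      q r = ≈-refl
  ⊗-distribˡ (a ∷ p) q r = begin
    a · (q ⊕ r) ⊕ shift (p ⊗ (q ⊕ r))
      ≈⟨ ⊕-cong (·-distribˡ a q r) (≈-trans (shift-cong (⊗-distribˡ p q r)) (shift-⊕ (p ⊗ q) (p ⊗ r))) ⟩
    (a · q ⊕ a · r) ⊕ (shift (p ⊗ q) ⊕ shift (p ⊗ r))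
      ≈⟨ ⊕-interchange (a · q) (a · r) (shift (p ⊗ q)) (shift (p ⊗ r)) ⟩
    (a · q ⊕ shift (p ⊗ q)) ⊕ (a · r ⊕ shift (p ⊗ r)) ∎
    where open ≈-Reasoning

  ⊗-distribʳ-⊖ : ∀ p q r → (p ⊖ q) ⊗ r ≈ p ⊗ r ⊖ q ⊗ r
  ⊗-distribʳ-⊖ p q r = ≈-trans (⊗-distribʳ p (⊖ q) r) (⊕-congʳ (p ⊗ r) (⊗-·ˡ (- 1ℚ) q r))

  ⊗-distribˡ-⊖ : ∀ p q r → p ⊗ (q ⊖ r) ≈ p ⊗ q ⊖ p ⊗ r
  ⊗-distribˡ-⊖ p q r = ≈-trans (⊗-distribˡ p q (⊖ r)) (⊕-congʳ (p ⊗ q) (⊗-·ʳ (- 1ℚ) p r))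

  ⊗-constʳ : ∀ c p → p ⊗ (c ∷ []) ≈ c · p
  ⊗-constʳ c []      = ≈-refl
  ⊗-constʳ c (a ∷ p) = begin
    a · (c ∷ []) ⊕ shift (p ⊗ (c ∷ []))  ≈⟨ ⊕-congʳ (a · (c ∷ [])) (shift-cong (⊗-constʳ c p)) ⟩
    ((a * c) ∷ []) ⊕ shift (c · p)        ≈⟨ coeffwise (λ { zero → trans (ℚP.+-identityʳ (a * c)) (ℚP.*-comm a c)
                                                         ; (suc j) → refl }) ⟩
    c · (a ∷ p)                           ∎
    where open ≈-Reasoning

  ⊗-comm : ∀ p q → p ⊗ q ≈ q ⊗ p
  ⊗-comm []      q = ≈-sym (⊗-zeroʳ q)
  ⊗-comm (a ∷ p) q = begin
    a · q ⊕ shift (p ⊗ q)       ≈⟨ ⊕-cong (≈-sym (⊗-constʳ a q)) (≈-trans (shift-cong (⊗-comm p q)) (≈-sym (⊗-shiftʳ q p))) ⟩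
    q ⊗ (a ∷ []) ⊕ q ⊗ shift p  ≈⟨ ≈-sym (⊗-distribˡ q (a ∷ []) (shift p)) ⟩
    q ⊗ ((a ∷ []) ⊕ shift p)    ≈⟨ ⊗-congʳ q (coeffwise λ { zero → ℚP.+-identityʳ a ; (suc j) → refl }) ⟩
    q ⊗ (a ∷ p)                 ∎
    where open ≈-Reasoning

  ⊗-assoc : ∀ p q r → (p ⊗ q) ⊗ r ≈ p ⊗ (q ⊗ r)
  ⊗-assoc []      q r = ≈-refl
  ⊗-assoc (a ∷ p) q r = begin
    (a · q ⊕ shift (p ⊗ q)) ⊗ r        ≈⟨ ⊗-distribʳ (a · q) (shift (p ⊗ q)) r ⟩
    (a · q) ⊗ r ⊕ shift (p ⊗ q) ⊗ r    ≈⟨ ⊕-cong (⊗-·ˡ a q r) (≈-trans (⊗-shiftˡ (p ⊗ q) r) (shift-cong (⊗-assoc p q r))) ⟩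
    a · (q ⊗ r) ⊕ shift (p ⊗ (q ⊗ r))  ∎
    where open ≈-Reasoning

  ⊕-comm : ∀ p q → p ⊕ q ≈ q ⊕ p
  ⊕-comm p q = coeffwise λ j →
    trans (coeff-⊕ p q j) (trans (ℚP.+-comm (coeff p j) (coeff q j)) (sym (coeff-⊕ q p j)))

  ⊕-assoc : ∀ p q r → (p ⊕ q) ⊕ r ≈ p ⊕ (q ⊕ r)
  ⊕-assoc p q r = coeffwise λ j → begin
    coeff ((p ⊕ q) ⊕ r) j                 ≡⟨ trans (coeff-⊕ (p ⊕ q) r j) (cong (_+ coeff r j) (coeff-⊕ p q j)) ⟩
    (coeff p j + coeff q j) + coeff r j   ≡⟨ ℚP.+-assoc (coeff p j) _ _ ⟩
    coeff p j + (coeff q j + coeff r j)   ≡⟨ sym (trans (coeff-⊕ p (q ⊕ r) j) (cong (λ x → coeff p j + x) (coeff-⊕ q r j))) ⟩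
    coeff (p ⊕ (q ⊕ r)) j                 ∎
    where open ≡-Reasoning

  ∂-⊕ : ∀ p q → ∂ (p ⊕ q) ≈ ∂ p ⊕ ∂ q
  ∂-⊕ p q = coeffwise λ j → let n = fromℕ (suc j) in begin
    coeff (∂ (p ⊕ q)) j                                  ≡⟨ coeff-∂ (p ⊕ q) j ⟩
    n * coeff (p ⊕ q) (suc j)                            ≡⟨ cong (n *_) (coeff-⊕ p q (suc j)) ⟩
    n * (coeff p (suc j) + coeff q (suc j))              ≡⟨ ℚP.*-distribˡ-+ n _ _ ⟩
    n * coeff p (suc j) + n * coeff q (suc j)            ≡⟨ sym (cong₂ _+_ (coeff-∂ p j) (coeff-∂ q j)) ⟩
    coeff (∂ p) j + coeff (∂ q) j                        ≡⟨ sym (coeff-⊕ (∂ p) (∂ q) j) ⟩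
    coeff (∂ p ⊕ ∂ q) j                                  ∎
    where open ≡-Reasoning

  ∂-· : ∀ c p → ∂ (c · p) ≈ c · ∂ p
  ∂-· c p = coeffwise λ j → let n = fromℕ (suc j) in begin
    coeff (∂ (c · p)) j             ≡⟨ trans (coeff-∂ (c · p) j) (cong (n *_) (coeff-· c p (suc j))) ⟩
    n * (c * coeff p (suc j))       ≡⟨ solve 3 (λ n c x → n :* (c :* x) := c :* (n :* x)) refl n c (coeff p (suc j)) ⟩
    c * (n * coeff p (suc j))       ≡⟨ sym (trans (coeff-· c (∂ p) j) (cong (c *_) (coeff-∂ p j))) ⟩
    coeff (c · ∂ p) j               ∎
    where open ≡-Reasoning

  ∂-⊖ : ∀ p q → ∂ (p ⊖ q) ≈ ∂ p ⊖ ∂ q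
  ∂-⊖ p q = ≈-trans (∂-⊕ p (⊖ q)) (⊕-congʳ (∂ p) (∂-· (- 1ℚ) q))

  ∂-⊗ : ∀ p q → ∂ (p ⊗ q) ≈ ∂ p ⊗ q ⊕ p ⊗ ∂ q
  ∂-⊗ []      q = ≈-refl
  ∂-⊗ (a ∷ p) q = begin
    ∂ (a · q ⊕ shift (p ⊗ q))
      ≈⟨ ∂-⊕ (a · q) (shift (p ⊗ q)) ⟩
    ∂ (a · q) ⊕ (p ⊗ q ⊕ shift (∂ (p ⊗ q)))
      ≈⟨ ⊕-cong (∂-· a q) (⊕-congʳ (p ⊗ q) (≈-trans (shift-cong (∂-⊗ p q)) (shift-⊕ (∂ p ⊗ q) (p ⊗ ∂ q)))) ⟩
    A ⊕ (B ⊕ (C ⊕ E))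
      ≈⟨ ≈-sym (⊕-assoc A B (C ⊕ E)) ⟩
    (A ⊕ B) ⊕ (C ⊕ E)
      ≈⟨ ⊕-congˡ (C ⊕ E) (⊕-comm A B) ⟩
    (B ⊕ A) ⊕ (C ⊕ E)
      ≈⟨ ⊕-interchange B A C E ⟩
    (B ⊕ C) ⊕ (A ⊕ E)
      ≈⟨ ⊕-congˡ (A ⊕ E) (≈-trans (⊕-congʳ B (≈-sym (⊗-shiftˡ (∂ p) q))) (≈-sym (⊗-distribʳ p (shift (∂ p)) q))) ⟩
    (p ⊕ shift (∂ p)) ⊗ q ⊕ (a · ∂ q ⊕ shift (p ⊗ ∂ q)) ∎
    where
    open ≈-Reasoning
    A = a · ∂ q
    B = p ⊗ q
    C = shift (∂ p ⊗ q)
    E = shift (p ⊗ ∂ q)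

  ⊗-left-comm : ∀ p q r → p ⊗ (q ⊗ r) ≈ q ⊗ (p ⊗ r)
  ⊗-left-comm p q r = begin
    p ⊗ (q ⊗ r)  ≈⟨ ≈-sym (⊗-assoc p q r) ⟩
    (p ⊗ q) ⊗ r  ≈⟨ ⊗-congˡ r (⊗-comm p q) ⟩
    (q ⊗ p) ⊗ r  ≈⟨ ⊗-assoc q p r ⟩
    q ⊗ (p ⊗ r)  ∎
    where open ≈-Reasoning

  one : Poly
  one = 1ℚ ∷ []

  X : Poly
  X = shift one

  infixr 8 _^ₚ_
  _^ₚ_ : Poly → ℕ → Poly
  p ^ₚ zero  = one
  p ^ₚ suc n = p ⊗ p ^ₚ n

  ⊗-identityˡ : ∀ p → one ⊗ p ≈ p
  ⊗-identityˡ p = ≈-trans (⊕-congʳ (1ℚ · p) shift-[]) (≈-trans (⊕-identityʳ (1ℚ · p)) (·-identityˡ p))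

  infix 4 _≈[_]_
  record _≈[_]_ (p : Poly) (n : ℕ) (q : Poly) : Set where
    constructor below
    field at< : ∀ j → j ℕ.< n → coeff p j ≡ coeff q j
  open _≈[_]_ public

  ≈⇒≈[] : ∀ {p q n} → p ≈ q → p ≈[ n ] q
  ≈⇒≈[] e = below λ j _ → at e j

  ≈[]-trans : ∀ {p q r n} → p ≈[ n ] q → q ≈[ n ] r → p ≈[ n ] r
  ≈[]-trans e f = below λ j j<n → trans (at< e j j<n) (at< f j j<n)

  ≈[]-weaken : ∀ {p q m n} → m ℕ.≤ n → p ≈[ n ] q → p ≈[ m ] q
  ≈[]-weaken m≤n e = below λ j j<m → at< e j (ℕP.<-≤-trans j<m m≤n)

  ≈[]-⊕ : ∀ {p p' q q' n} → p ≈[ n ] p' → q ≈[ n ] q' → p ⊕ q ≈[ n ] p' ⊕ q'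
  ≈[]-⊕ {p} {p'} {q} {q'} e f = below λ j j<n →
    trans (coeff-⊕ p q j) (trans (cong₂ _+_ (at< e j j<n) (at< f j j<n)) (sym (coeff-⊕ p' q' j)))

  ≈[]-· : ∀ c {p q n} → p ≈[ n ] q → c · p ≈[ n ] c · q
  ≈[]-· c {p} {q} e = below λ j j<n →
    trans (coeff-· c p j) (trans (cong (c *_) (at< e j j<n)) (sym (coeff-· c q j)))

  ≈[]-⊖ : ∀ {p p' q q' n} → p ≈[ n ] p' → q ≈[ n ] q' → p ⊖ q ≈[ n ] p' ⊖ q'
  ≈[]-⊖ e f = ≈[]-⊕ e (≈[]-· (- 1ℚ) f)

  shift-≈[] : ∀ {p q n} → p ≈[ n ] q → shift p ≈[ suc n ] shift q
  shift-≈[] e = below λ { zero _ → refl ; (suc j) (ℕ.s≤s j<n) → at< e j j<n }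

  ⊗-congʳ-≈[] : ∀ r {p q n} → p ≈[ n ] q → r ⊗ p ≈[ n ] r ⊗ q
  ⊗-congʳ-≈[] []      e = below λ _ _ → refl
  ⊗-congʳ-≈[] (a ∷ r) e = ≈[]-⊕ (≈[]-· a e) (≈[]-weaken (ℕP.n≤1+n _) (shift-≈[] (⊗-congʳ-≈[] r e)))

  shift-^ₚ-≈[] : ∀ p n → shift p ^ₚ n ≈[ n ] []
  shift-^ₚ-≈[] p zero    = below λ _ ()
  shift-^ₚ-≈[] p (suc n) = ≈[]-trans (≈⇒≈[] (⊗-shiftˡ p (shift p ^ₚ n)))
    (≈[]-trans (shift-≈[] (⊗-congʳ-≈[] p (shift-^ₚ-≈[] p n))) (≈⇒≈[] (≈-trans (shift-cong (⊗-zeroʳ p)) shift-[])))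

  one⊖X⊗ : ∀ p → (one ⊖ X) ⊗ p ≈ p ⊖ shift p
  one⊖X⊗ p = ≈-trans (⊗-distribʳ-⊖ one X p)
    (⊖-cong (⊗-identityˡ p) (≈-trans (⊗-shiftˡ one p) (shift-cong (⊗-identityˡ p))))

  one⊖X⊗-cancel : ∀ {p n} → (one ⊖ X) ⊗ p ≈[ n ] [] → p ≈[ n ] []
  one⊖X⊗-cancel {p} {n} e = below vanish
    where
    difference : ∀ j → j ℕ.< n → coeff p j - coeff (shift p) j ≡ 0ℚ
    difference j j<n = trans (sym (coeff-⊖ p (shift p) j)) (trans (sym (at (one⊖X⊗ p) j)) (at< e j j<n))
    vanish : ∀ j → j ℕ.< n → coeff p j ≡ 0ℚ
    vanish zero    0<n  = trans (sym (ℚP.+-identityʳ (coeff p 0))) (difference 0 0<n)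
    vanish (suc j) sj<n = begin
      coeff p (suc j)                                 ≡⟨ solve 2 (λ x y → x := (x :- y) :+ y) refl (coeff p (suc j)) (coeff p j) ⟩
      (coeff p (suc j) - coeff p j) + coeff p j       ≡⟨ cong₂ _+_ (difference (suc j) sj<n) (vanish j (ℕP.<-trans (ℕP.n<1+n j) sj<n)) ⟩
      0ℚ                                              ∎
      where open ≡-Reasoning

  ∂-≈[]-integrate : ∀ {p n} → ∂ p ≈[ n ] [] → coeff p 0 ≡ 0ℚ → p ≈[ suc n ] []
  ∂-≈[]-integrate {p} e p₀≡0 = below λ
    { zero    _               → p₀≡0
    ; (suc j) (ℕ.s≤s j<n) → let open ≡-Reasoning in begin
        coeff p (suc j)                                    ≡⟨ sym (ℚP.*-identityˡ _) ⟩
        1ℚ * coeff p (suc j)                               ≡⟨ cong (_* coeff p (suc j)) (sym (trans (ℚP.*-comm 1/[1+ j ] _) ([1+]*1/[1+] j))) ⟩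
        (1/[1+ j ] * fromℕ (suc j)) * coeff p (suc j)     ≡⟨ ℚP.*-assoc 1/[1+ j ] _ _ ⟩
        1/[1+ j ] * (fromℕ (suc j) * coeff p (suc j))     ≡⟨ cong (1/[1+ j ] *_) (trans (sym (coeff-∂ p j)) (at< e j j<n)) ⟩
        1/[1+ j ] * 0ℚ                                     ≡⟨ ℚP.*-zeroʳ 1/[1+ j ] ⟩
        0ℚ                                                 ∎ }

module TruncatedLogarithm where

  open import Data.Rational using (_+_; _-_)
  open Fractions
  open Polynomials
  open ℚ-Solver.+-*-Solver

  geomSum : Poly → ℕ → Poly
  geomSum p zero    = []
  geomSum p (suc N) = geomSum p N ⊕ p ^ₚ N

  logSum : Poly → ℕ → Poly
  logSum p zero    = []
  logSum p (suc N) = logSum p N ⊕ 1/[1+ N ] · p ^ₚ suc N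

  ∂-^ₚ : ∀ p n → ∂ (p ^ₚ suc n) ≈ fromℕ (suc n) · (∂ p ⊗ p ^ₚ n)
  ∂-^ₚ p zero = begin
    ∂ (p ⊗ one)               ≈⟨ ∂-⊗ p one ⟩
    ∂ p ⊗ one ⊕ p ⊗ shift []  ≈⟨ ⊕-congʳ (∂ p ⊗ one) (≈-trans (⊗-congʳ p shift-[]) (⊗-zeroʳ p)) ⟩
    ∂ p ⊗ one ⊕ []            ≈⟨ ⊕-identityʳ (∂ p ⊗ one) ⟩
    ∂ p ⊗ one                 ≈⟨ ≈-sym (·-identityˡ (∂ p ⊗ one)) ⟩
    1ℚ · (∂ p ⊗ one)          ∎
    where open ≈-Reasoning
  ∂-^ₚ p (suc n) = begin
    ∂ (p ⊗ P)                              ≈⟨ ∂-⊗ p P ⟩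
    ∂ p ⊗ P ⊕ p ⊗ ∂ P                      ≈⟨ ⊕-cong (≈-sym (·-identityˡ (∂ p ⊗ P))) (⊗-congʳ p (∂-^ₚ p n)) ⟩
    1ℚ · (∂ p ⊗ P) ⊕ p ⊗ (k · (∂ p ⊗ Q))   ≈⟨ ⊕-congʳ (1ℚ · (∂ p ⊗ P)) (≈-trans (⊗-·ʳ k p (∂ p ⊗ Q)) (·-congʳ k (⊗-left-comm p (∂ p) Q))) ⟩
    1ℚ · (∂ p ⊗ P) ⊕ k · (∂ p ⊗ P)         ≈⟨ ≈-sym (·-distribʳ 1ℚ k (∂ p ⊗ P)) ⟩
    (1ℚ + k) · (∂ p ⊗ P)                   ≈⟨ ·-cong (sym (fromℤ-+ (+ 1) (+ suc n))) ≈-refl ⟩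
    fromℕ (suc (suc n)) · (∂ p ⊗ P)        ∎
    where
    open ≈-Reasoning
    k = fromℕ (suc n)
    Q = p ^ₚ n
    P = p ^ₚ suc n

  ∂-logSum : ∀ p N → ∂ (logSum p N) ≈ ∂ p ⊗ geomSum p N
  ∂-logSum p zero    = ≈-sym (⊗-zeroʳ (∂ p))
  ∂-logSum p (suc N) = begin
    ∂ (logSum p N ⊕ c · p ^ₚ suc N)                       ≈⟨ ∂-⊕ (logSum p N) (c · p ^ₚ suc N) ⟩
    ∂ (logSum p N) ⊕ ∂ (c · p ^ₚ suc N)                   ≈⟨ ⊕-cong (∂-logSum p N) (≈-trans (∂-· c (p ^ₚ suc N)) (·-congʳ c (∂-^ₚ p N))) ⟩
    ∂ p ⊗ geomSum p N ⊕ c · (fromℕ (suc N) · (∂ p ⊗ p ^ₚ N))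
      ≈⟨ ⊕-congʳ (∂ p ⊗ geomSum p N) (≈-trans (·-assoc c (fromℕ (suc N)) (∂ p ⊗ p ^ₚ N))
           (≈-trans (·-cong (trans (ℚP.*-comm c (fromℕ (suc N))) ([1+]*1/[1+] N)) ≈-refl) (·-identityˡ (∂ p ⊗ p ^ₚ N)))) ⟩
    ∂ p ⊗ geomSum p N ⊕ ∂ p ⊗ p ^ₚ N                      ≈⟨ ≈-sym (⊗-distribˡ (∂ p) (geomSum p N) (p ^ₚ N)) ⟩
    ∂ p ⊗ (geomSum p N ⊕ p ^ₚ N)                          ∎
    where
    open ≈-Reasoning
    c = 1/[1+ N ]

  ⊖-telescope : ∀ p q r → (p ⊖ q) ⊕ (q ⊖ r) ≈ p ⊖ r
  ⊖-telescope p q r = coeffwise λ j → begin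
    coeff ((p ⊖ q) ⊕ (q ⊖ r)) j                      ≡⟨ trans (coeff-⊕ (p ⊖ q) (q ⊖ r) j) (cong₂ _+_ (coeff-⊖ p q j) (coeff-⊖ q r j)) ⟩
    (coeff p j - coeff q j) + (coeff q j - coeff r j) ≡⟨ solve 3 (λ a b c → (a :- b) :+ (b :- c) := a :- c) refl (coeff p j) (coeff q j) (coeff r j) ⟩
    coeff p j - coeff r j                            ≡⟨ sym (coeff-⊖ p r j) ⟩
    coeff (p ⊖ r) j                                  ∎
    where open ≡-Reasoning

  one⊖-⊗-geomSum : ∀ p N → (one ⊖ p) ⊗ geomSum p N ≈ one ⊖ p ^ₚ N
  one⊖-⊗-geomSum p zero    = ≈-trans (⊗-zeroʳ (one ⊖ p)) (≈-sym (⊖-self one))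
  one⊖-⊗-geomSum p (suc N) = begin
    (one ⊖ p) ⊗ (geomSum p N ⊕ p ^ₚ N)                     ≈⟨ ⊗-distribˡ (one ⊖ p) (geomSum p N) (p ^ₚ N) ⟩
    (one ⊖ p) ⊗ geomSum p N ⊕ (one ⊖ p) ⊗ p ^ₚ N          ≈⟨ ⊕-cong (one⊖-⊗-geomSum p N) (≈-trans (⊗-distribʳ-⊖ one p (p ^ₚ N)) (⊖-cong (⊗-identityˡ (p ^ₚ N)) ≈-refl)) ⟩
    (one ⊖ p ^ₚ N) ⊕ (p ^ₚ N ⊖ p ^ₚ suc N)                 ≈⟨ ⊖-telescope one (p ^ₚ N) (p ^ₚ suc N) ⟩
    one ⊖ p ^ₚ suc N                                       ∎
    where open ≈-Reasoning

  one⊖-⊗-∂-logSum : ∀ p N → (one ⊖ p) ⊗ ∂ (logSum p N) ≈ ∂ p ⊗ (one ⊖ p ^ₚ N)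
  one⊖-⊗-∂-logSum p N = begin
    (one ⊖ p) ⊗ ∂ (logSum p N)           ≈⟨ ⊗-congʳ (one ⊖ p) (∂-logSum p N) ⟩
    (one ⊖ p) ⊗ (∂ p ⊗ geomSum p N)      ≈⟨ ⊗-left-comm (one ⊖ p) (∂ p) (geomSum p N) ⟩
    ∂ p ⊗ ((one ⊖ p) ⊗ geomSum p N)      ≈⟨ ⊗-congʳ (∂ p) (one⊖-⊗-geomSum p N) ⟩
    ∂ p ⊗ (one ⊖ p ^ₚ N)                 ∎
    where open ≈-Reasoning

  logSum-≈[1] : ∀ q N → logSum (shift q) N ≈[ 1 ] []
  logSum-≈[1] q zero    = ≈⇒≈[] ≈-refl
  logSum-≈[1] q (suc N) = ≈[]-⊕ (logSum-≈[1] q N)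
    (≈[]-· 1/[1+ N ] (≈[]-weaken (ℕ.s≤s ℕ.z≤n) (shift-^ₚ-≈[] q (suc N))))

module LogarithmOfCube where

  open import Data.Rational using (0ℚ; -_)
  open Fractions
  open Polynomials
  open TruncatedLogarithm

  L : Poly
  L = one ⊖ X

  g/X g : Poly
  g/X = three ∷ - three ∷ 1ℚ ∷ []
  g   = shift g/X

  one⊖g≈L³ : one ⊖ g ≈ L ⊗ (L ⊗ L)
  one⊖g≈L³ = coeffwise λ { 0 → refl ; 1 → refl ; 2 → refl ; 3 → refl ; (suc (suc (suc (suc j)))) → refl }

  ∂g≈3L² : ∂ g ≈ three · (L ⊗ L)
  ∂g≈3L² = coeffwise λ { 0 → refl ; 1 → refl ; 2 → refl ; 3 → refl ; (suc (suc (suc (suc j)))) → refl }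

  ∂X≈one : ∂ X ≈ one
  ∂X≈one = coeffwise λ { 0 → refl ; 1 → refl ; (suc (suc j)) → refl }

  E : ℕ → Poly
  E N = three · logSum X N ⊖ logSum g N

  L³⊗∂E : ∀ N → L ⊗ (L ⊗ (L ⊗ ∂ (E N))) ≈ three · ((L ⊗ L) ⊗ ((one ⊖ X ^ₚ N) ⊖ (one ⊖ g ^ₚ N)))
  L³⊗∂E N = begin
    L ⊗ (L ⊗ (L ⊗ ∂ (E N)))
      ≈⟨ ≈-sym (≈-trans (⊗-assoc L (L ⊗ L) (∂ (E N))) (⊗-congʳ L (⊗-assoc L L (∂ (E N))))) ⟩
    L³ ⊗ ∂ (three · logSum X N ⊖ logSum g N)
      ≈⟨ ⊗-congʳ L³ (≈-trans (∂-⊖ (three · logSum X N) (logSum g N)) (⊖-cong (∂-· three (logSum X N)) ≈-refl)) ⟩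
    L³ ⊗ (three · ∂logX ⊖ ∂logg)
      ≈⟨ ≈-trans (⊗-distribˡ-⊖ L³ (three · ∂logX) ∂logg) (⊖-cong (⊗-·ʳ three L³ ∂logX) ≈-refl) ⟩
    three · (L³ ⊗ ∂logX) ⊖ L³ ⊗ ∂logg
      ≈⟨ ⊖-cong (·-congʳ three (≈-trans (⊗-congˡ ∂logX (⊗-comm L (L ⊗ L))) (⊗-assoc (L ⊗ L) L ∂logX)))
                (⊗-congˡ ∂logg (≈-sym one⊖g≈L³)) ⟩
    three · ((L ⊗ L) ⊗ (L ⊗ ∂logX)) ⊖ (one ⊖ g) ⊗ ∂logg
      ≈⟨ ⊖-cong (·-congʳ three (⊗-congʳ (L ⊗ L) (one⊖-⊗-∂-logSum X N))) (one⊖-⊗-∂-logSum g N) ⟩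
    three · ((L ⊗ L) ⊗ (∂ X ⊗ (one ⊖ X ^ₚ N))) ⊖ ∂ g ⊗ (one ⊖ g ^ₚ N)
      ≈⟨ ⊖-cong (·-congʳ three (⊗-congʳ (L ⊗ L) (≈-trans (⊗-congˡ (one ⊖ X ^ₚ N) ∂X≈one) (⊗-identityˡ (one ⊖ X ^ₚ N)))))
                (≈-trans (⊗-congˡ (one ⊖ g ^ₚ N) ∂g≈3L²) (⊗-·ˡ three (L ⊗ L) (one ⊖ g ^ₚ N))) ⟩
    three · ((L ⊗ L) ⊗ (one ⊖ X ^ₚ N)) ⊖ three · ((L ⊗ L) ⊗ (one ⊖ g ^ₚ N))
      ≈⟨ ≈-sym (≈-trans (·-congʳ three (⊗-distribˡ-⊖ (L ⊗ L) (one ⊖ X ^ₚ N) (one ⊖ g ^ₚ N)))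
                        (·-distrib-⊖ three ((L ⊗ L) ⊗ (one ⊖ X ^ₚ N)) ((L ⊗ L) ⊗ (one ⊖ g ^ₚ N)))) ⟩
    three · ((L ⊗ L) ⊗ ((one ⊖ X ^ₚ N) ⊖ (one ⊖ g ^ₚ N))) ∎
    where
    open ≈-Reasoning
    L³ = L ⊗ (L ⊗ L)
    ∂logX = ∂ (logSum X N)
    ∂logg = ∂ (logSum g N)

  E-≈[] : ∀ N → E N ≈[ suc N ] []
  E-≈[] N = ∂-≈[]-integrate (one⊖X⊗-cancel (one⊖X⊗-cancel (one⊖X⊗-cancel L³⊗∂E≈[]))) E₀≡0
    where
    powers-agree : (one ⊖ X ^ₚ N) ⊖ (one ⊖ g ^ₚ N) ≈[ N ] []
    powers-agree = ≈[]-trans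
      (≈[]-⊖ (≈[]-⊖ (≈⇒≈[] (≈-refl {one})) (shift-^ₚ-≈[] one N))
             (≈[]-⊖ (≈⇒≈[] (≈-refl {one})) (shift-^ₚ-≈[] g/X N)))
      (≈⇒≈[] (⊖-self (one ⊖ [])))
    L³⊗∂E≈[] : L ⊗ (L ⊗ (L ⊗ ∂ (E N))) ≈[ N ] []
    L³⊗∂E≈[] = ≈[]-trans (≈⇒≈[] (L³⊗∂E N))
      (≈[]-trans (≈[]-· three (⊗-congʳ-≈[] (L ⊗ L) powers-agree)) (≈⇒≈[] (·-congʳ three (⊗-zeroʳ (L ⊗ L)))))
    E₀≡0 : coeff (E N) 0 ≡ 0ℚ
    E₀≡0 = at< (≈[]-⊖ (≈[]-· three (logSum-≈[1] one N)) (logSum-≈[1] g/X N)) 0 (ℕ.s≤s ℕ.z≤n)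

module QuadraticField where

  open import Data.Rational using (0ℚ; _+_; _*_; -_; _-_)
  open Fractions
  open Polynomials
  open TruncatedLogarithm using (logSum)
  open ℚ-Solver.+-*-Solver

  -- (a , b) stands for a + b √-3.
  ℚ[√-3] : Set
  ℚ[√-3] = ℚ × ℚ

  re im : ℚ[√-3] → ℚ
  re = proj₁
  im = proj₂

  infixl 6 _+ᵣ_
  infixl 7 _*ᵣ_

  _+ᵣ_ : ℚ[√-3] → ℚ[√-3] → ℚ[√-3]
  (a , b) +ᵣ (c , d) = (a + c , b + d)

  _*ᵣ_ : ℚ[√-3] → ℚ[√-3] → ℚ[√-3]
  (a , b) *ᵣ (c , d) = (a * c - three * (b * d) , a * d + b * c)

  ιᵣ : ℚ → ℚ[√-3]
  ιᵣ a = (a , 0ℚ)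

  0ᵣ 1ᵣ √-3 : ℚ[√-3]
  0ᵣ = ιᵣ 0ℚ
  1ᵣ = ιᵣ 1ℚ
  √-3 = (0ℚ , 1ℚ)

  _^ᵣ_ : ℚ[√-3] → ℕ → ℚ[√-3]
  z ^ᵣ zero  = 1ᵣ
  z ^ᵣ suc n = z *ᵣ z ^ᵣ n

  +ᵣ-identityˡ : ∀ x → 0ᵣ +ᵣ x ≡ x
  +ᵣ-identityˡ (a , b) = cong₂ _,_ (ℚP.+-identityˡ a) (ℚP.+-identityˡ b)

  +ᵣ-identityʳ : ∀ x → x +ᵣ 0ᵣ ≡ x
  +ᵣ-identityʳ (a , b) = cong₂ _,_ (ℚP.+-identityʳ a) (ℚP.+-identityʳ b)

  +ᵣ-interchange : ∀ w x y z → (w +ᵣ x) +ᵣ (y +ᵣ z) ≡ (w +ᵣ y) +ᵣ (x +ᵣ z)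
  +ᵣ-interchange (a , a') (b , b') (c , c') (d , d') = cong₂ _,_ (swap a b c d) (swap a' b' c' d')
    where
    swap : ∀ w x y z → (w + x) + (y + z) ≡ (w + y) + (x + z)
    swap = solve 4 (λ w x y z → (w :+ x) :+ (y :+ z) := (w :+ y) :+ (x :+ z)) refl

  *ᵣ-comm : ∀ x y → x *ᵣ y ≡ y *ᵣ x
  *ᵣ-comm (a , b) (c , d) = cong₂ _,_
    (solve 4 (λ a b c d → a :* c :- con three :* (b :* d) := c :* a :- con three :* (d :* b)) refl a b c d)
    (solve 4 (λ a b c d → a :* d :+ b :* c := c :* b :+ d :* a) refl a b c d)

  *ᵣ-assoc : ∀ x y z → (x *ᵣ y) *ᵣ z ≡ x *ᵣ (y *ᵣ z)
  *ᵣ-assoc (a , b) (c , d) (e , f) = cong₂ _,_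
    (solve 6 (λ a b c d e f → (a :* c :- con three :* (b :* d)) :* e :- con three :* ((a :* d :+ b :* c) :* f)
                           := a :* (c :* e :- con three :* (d :* f)) :- con three :* (b :* (c :* f :+ d :* e))) refl a b c d e f)
    (solve 6 (λ a b c d e f → (a :* c :- con three :* (b :* d)) :* f :+ (a :* d :+ b :* c) :* e
                           := a :* (c :* f :+ d :* e) :+ b :* (c :* e :- con three :* (d :* f))) refl a b c d e f)

  *ᵣ-distribˡ : ∀ x y z → x *ᵣ (y +ᵣ z) ≡ x *ᵣ y +ᵣ x *ᵣ z
  *ᵣ-distribˡ (a , b) (c , d) (e , f) = cong₂ _,_
    (solve 6 (λ a b c d e f → a :* (c :+ e) :- con three :* (b :* (d :+ f))
                           := (a :* c :- con three :* (b :* d)) :+ (a :* e :- con three :* (b :* f))) refl a b c d e f)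
    (solve 6 (λ a b c d e f → a :* (d :+ f) :+ b :* (c :+ e) := (a :* d :+ b :* c) :+ (a :* f :+ b :* e)) refl a b c d e f)

  *ᵣ-distribʳ : ∀ x y z → (y +ᵣ z) *ᵣ x ≡ y *ᵣ x +ᵣ z *ᵣ x
  *ᵣ-distribʳ x y z = trans (*ᵣ-comm (y +ᵣ z) x) (trans (*ᵣ-distribˡ x y z) (cong₂ _+ᵣ_ (*ᵣ-comm x y) (*ᵣ-comm x z)))

  *ᵣ-zeroʳ : ∀ x → x *ᵣ 0ᵣ ≡ 0ᵣ
  *ᵣ-zeroʳ (a , b) = cong₂ _,_
    (solve 2 (λ a b → a :* con 0ℚ :- con three :* (b :* con 0ℚ) := con 0ℚ) refl a b)
    (solve 2 (λ a b → a :* con 0ℚ :+ b :* con 0ℚ := con 0ℚ) refl a b)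

  *ᵣ-identityˡ : ∀ x → 1ᵣ *ᵣ x ≡ x
  *ᵣ-identityˡ (a , b) = cong₂ _,_
    (solve 2 (λ a b → con 1ℚ :* a :- con three :* (con 0ℚ :* b) := a) refl a b)
    (solve 2 (λ a b → con 1ℚ :* b :+ con 0ℚ :* a := b) refl a b)

  ιᵣ-+ : ∀ a b → ιᵣ (a + b) ≡ ιᵣ a +ᵣ ιᵣ b
  ιᵣ-+ a b = cong (a + b ,_) (sym (ℚP.+-identityˡ 0ℚ))

  ιᵣ-* : ∀ a b → ιᵣ (a * b) ≡ ιᵣ a *ᵣ ιᵣ b
  ιᵣ-* a b = cong₂ _,_
    (solve 2 (λ a b → a :* b := a :* b :- con three :* (con 0ℚ :* con 0ℚ)) refl a b)
    (solve 2 (λ a b → con 0ℚ := a :* con 0ℚ :+ con 0ℚ :* b) refl a b)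

  im-ιᵣ-* : ∀ a x → im (ιᵣ a *ᵣ x) ≡ a * im x
  im-ιᵣ-* a (b , c) = solve 3 (λ a b c → a :* c :+ con 0ℚ :* b := a :* c) refl a b c

  im-*ᵣ-real : ∀ x y → im x ≡ 0ℚ → im y ≡ 0ℚ → im (x *ᵣ y) ≡ 0ℚ
  im-*ᵣ-real (a , _) (c , _) refl refl = solve 2 (λ a c → a :* con 0ℚ :+ con 0ℚ :* c := con 0ℚ) refl a c

  ev : Poly → ℚ[√-3] → ℚ[√-3]
  ev []      z = 0ᵣ
  ev (a ∷ p) z = ιᵣ a +ᵣ z *ᵣ ev p z

  ev-≈[] : ∀ p z → p ≈ [] → ev p z ≡ 0ᵣ
  ev-≈[] []      z e = refl
  ev-≈[] (a ∷ p) z e = begin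
    ιᵣ a +ᵣ z *ᵣ ev p z   ≡⟨ cong₂ (λ u v → ιᵣ u +ᵣ z *ᵣ v) (at e 0) (ev-≈[] p z (∷-≈[]-tail e)) ⟩
    ιᵣ 0ℚ +ᵣ z *ᵣ 0ᵣ      ≡⟨ trans (+ᵣ-identityˡ (z *ᵣ 0ᵣ)) (*ᵣ-zeroʳ z) ⟩
    0ᵣ                    ∎
    where open ≡-Reasoning

  ev-cong : ∀ {p q} z → p ≈ q → ev p z ≡ ev q z
  ev-cong {[]}    {q}     z e = sym (ev-≈[] q z (≈-sym e))
  ev-cong {a ∷ p} {[]}    z e = ev-≈[] (a ∷ p) z e
  ev-cong {a ∷ p} {b ∷ q} z e = cong₂ (λ u v → ιᵣ u +ᵣ z *ᵣ v) (at e 0) (ev-cong z (∷-≈-tail e))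

  ev-⊕ : ∀ p q z → ev (p ⊕ q) z ≡ ev p z +ᵣ ev q z
  ev-⊕ []      q       z = sym (+ᵣ-identityˡ _)
  ev-⊕ (a ∷ p) []      z = sym (+ᵣ-identityʳ _)
  ev-⊕ (a ∷ p) (b ∷ q) z = begin
    ιᵣ (a + b) +ᵣ z *ᵣ ev (p ⊕ q) z                      ≡⟨ cong₂ (λ u v → u +ᵣ z *ᵣ v) (ιᵣ-+ a b) (ev-⊕ p q z) ⟩
    (ιᵣ a +ᵣ ιᵣ b) +ᵣ z *ᵣ (ev p z +ᵣ ev q z)            ≡⟨ cong ((ιᵣ a +ᵣ ιᵣ b) +ᵣ_) (*ᵣ-distribˡ z (ev p z) (ev q z)) ⟩
    (ιᵣ a +ᵣ ιᵣ b) +ᵣ (z *ᵣ ev p z +ᵣ z *ᵣ ev q z)       ≡⟨ +ᵣ-interchange (ιᵣ a) (ιᵣ b) (z *ᵣ ev p z) (z *ᵣ ev q z) ⟩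
    (ιᵣ a +ᵣ z *ᵣ ev p z) +ᵣ (ιᵣ b +ᵣ z *ᵣ ev q z)      ∎
    where open ≡-Reasoning

  ev-· : ∀ c p z → ev (c · p) z ≡ ιᵣ c *ᵣ ev p z
  ev-· c []      z = sym (*ᵣ-zeroʳ (ιᵣ c))
  ev-· c (a ∷ p) z = begin
    ιᵣ (c * a) +ᵣ z *ᵣ ev (c · p) z             ≡⟨ cong₂ (λ u v → u +ᵣ z *ᵣ v) (ιᵣ-* c a) (ev-· c p z) ⟩
    ιᵣ c *ᵣ ιᵣ a +ᵣ z *ᵣ (ιᵣ c *ᵣ ev p z)       ≡⟨ cong (ιᵣ c *ᵣ ιᵣ a +ᵣ_) (trans (sym (*ᵣ-assoc z (ιᵣ c) (ev p z)))
                                                     (trans (cong (_*ᵣ ev p z) (*ᵣ-comm z (ιᵣ c))) (*ᵣ-assoc (ιᵣ c) z (ev p z)))) ⟩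
    ιᵣ c *ᵣ ιᵣ a +ᵣ ιᵣ c *ᵣ (z *ᵣ ev p z)       ≡⟨ sym (*ᵣ-distribˡ (ιᵣ c) (ιᵣ a) (z *ᵣ ev p z)) ⟩
    ιᵣ c *ᵣ (ιᵣ a +ᵣ z *ᵣ ev p z)               ∎
    where open ≡-Reasoning

  ev-shift : ∀ p z → ev (shift p) z ≡ z *ᵣ ev p z
  ev-shift p z = +ᵣ-identityˡ _

  ev-⊗ : ∀ p q z → ev (p ⊗ q) z ≡ ev p z *ᵣ ev q z
  ev-⊗ []      q z = sym (trans (*ᵣ-comm 0ᵣ (ev q z)) (*ᵣ-zeroʳ (ev q z)))
  ev-⊗ (a ∷ p) q z = begin
    ev (a · q ⊕ shift (p ⊗ q)) z                 ≡⟨ ev-⊕ (a · q) (shift (p ⊗ q)) z ⟩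
    ev (a · q) z +ᵣ ev (shift (p ⊗ q)) z         ≡⟨ cong₂ _+ᵣ_ (ev-· a q z) (trans (ev-shift (p ⊗ q) z) (cong (z *ᵣ_) (ev-⊗ p q z))) ⟩
    ιᵣ a *ᵣ ev q z +ᵣ z *ᵣ (ev p z *ᵣ ev q z)    ≡⟨ cong (ιᵣ a *ᵣ ev q z +ᵣ_) (sym (*ᵣ-assoc z (ev p z) (ev q z))) ⟩
    ιᵣ a *ᵣ ev q z +ᵣ (z *ᵣ ev p z) *ᵣ ev q z    ≡⟨ sym (*ᵣ-distribʳ (ev q z) (ιᵣ a) (z *ᵣ ev p z)) ⟩
    (ιᵣ a +ᵣ z *ᵣ ev p z) *ᵣ ev q z              ∎
    where open ≡-Reasoning

  ev-^ₚ : ∀ p n z → ev (p ^ₚ n) z ≡ ev p z ^ᵣ n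
  ev-^ₚ p zero    z = trans (cong (ιᵣ 1ℚ +ᵣ_) (*ᵣ-zeroʳ z)) (+ᵣ-identityʳ 1ᵣ)
  ev-^ₚ p (suc n) z = trans (ev-⊗ p (p ^ₚ n) z) (cong (ev p z *ᵣ_) (ev-^ₚ p n z))

  ev-≈[]-drop : ∀ m p z → p ≈[ m ] [] → ev p z ≡ z ^ᵣ m *ᵣ ev (drop m p) z
  ev-≈[]-drop zero    p       z e = sym (*ᵣ-identityˡ (ev p z))
  ev-≈[]-drop (suc m) []      z e = sym (*ᵣ-zeroʳ (z ^ᵣ suc m))
  ev-≈[]-drop (suc m) (a ∷ p) z e = begin
    ιᵣ a +ᵣ z *ᵣ ev p z                        ≡⟨ cong₂ (λ u v → ιᵣ u +ᵣ z *ᵣ v) (at< e 0 (ℕ.s≤s ℕ.z≤n))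
                                                    (ev-≈[]-drop m p z (below λ j j<m → at< e (suc j) (ℕ.s≤s j<m))) ⟩
    ιᵣ 0ℚ +ᵣ z *ᵣ (z ^ᵣ m *ᵣ ev (drop m p) z)  ≡⟨ +ᵣ-identityˡ _ ⟩
    z *ᵣ (z ^ᵣ m *ᵣ ev (drop m p) z)           ≡⟨ sym (*ᵣ-assoc z (z ^ᵣ m) _) ⟩
    z ^ᵣ suc m *ᵣ ev (drop m p) z              ∎
    where open ≡-Reasoning

  logSumᵣ : ℚ[√-3] → ℕ → ℚ[√-3]
  logSumᵣ z zero    = 0ᵣ
  logSumᵣ z (suc N) = logSumᵣ z N +ᵣ ιᵣ 1/[1+ N ] *ᵣ z ^ᵣ suc N

  ev-logSum : ∀ p N z → ev (logSum p N) z ≡ logSumᵣ (ev p z) N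
  ev-logSum p zero    z = refl
  ev-logSum p (suc N) z = trans (ev-⊕ (logSum p N) (1/[1+ N ] · p ^ₚ suc N) z)
    (cong₂ _+ᵣ_ (ev-logSum p N z) (trans (ev-· 1/[1+ N ] (p ^ₚ suc N) z) (cong (ιᵣ 1/[1+ N ] *ᵣ_) (ev-^ₚ p (suc N) z))))

  im-logSumᵣ-real : ∀ x N → im x ≡ 0ℚ → im (logSumᵣ x N) ≡ 0ℚ
  im-logSumᵣ-real x zero    _    = refl
  im-logSumᵣ-real x (suc N) real = cong₂ _+_ (im-logSumᵣ-real x N real)
    (trans (im-ιᵣ-* 1/[1+ N ] (x ^ᵣ suc N)) (trans (cong (1/[1+ N ] *_) (real-power (suc N))) (ℚP.*-zeroʳ 1/[1+ N ])))
    where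
    real-power : ∀ n → im (x ^ᵣ n) ≡ 0ℚ
    real-power zero    = refl
    real-power (suc n) = im-*ᵣ-real x (x ^ᵣ n) real (real-power n)

  [-3]^_ : ℕ → ℚ
  [-3]^ m = fromℤ ((ℤ.- (+ 3)) ℤ.^ m)

  √-3^ᵣ-even : ∀ m → √-3 ^ᵣ (2 ℕ.* m) ≡ ιᵣ ([-3]^ m)
  √-3^ᵣ-even zero    = refl
  √-3^ᵣ-even (suc m) = begin
    √-3 ^ᵣ (2 ℕ.* suc m)                      ≡⟨ cong (√-3 ^ᵣ_) (ℕP.*-suc 2 m) ⟩
    √-3 *ᵣ (√-3 *ᵣ √-3 ^ᵣ (2 ℕ.* m))          ≡⟨ sym (*ᵣ-assoc √-3 √-3 (√-3 ^ᵣ (2 ℕ.* m))) ⟩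
    ιᵣ (fromℤ (ℤ.- (+ 3))) *ᵣ √-3 ^ᵣ (2 ℕ.* m) ≡⟨ cong (ιᵣ (fromℤ (ℤ.- (+ 3))) *ᵣ_) (√-3^ᵣ-even m) ⟩
    ιᵣ (fromℤ (ℤ.- (+ 3))) *ᵣ ιᵣ ([-3]^ m)     ≡⟨ sym (ιᵣ-* (fromℤ (ℤ.- (+ 3))) ([-3]^ m)) ⟩
    ιᵣ (fromℤ (ℤ.- (+ 3)) * [-3]^ m)           ≡⟨ cong ιᵣ (sym (fromℤ-* (ℤ.- (+ 3)) ((ℤ.- (+ 3)) ℤ.^ m))) ⟩
    ιᵣ ([-3]^ suc m)                          ∎
    where open ≡-Reasoning

  √-3^ᵣ-odd : ∀ m → √-3 ^ᵣ suc (2 ℕ.* m) ≡ (0ℚ , [-3]^ m)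
  √-3^ᵣ-odd m = trans (cong (√-3 *ᵣ_) (√-3^ᵣ-even m)) (cong₂ _,_
    (solve 1 (λ a → con 0ℚ :* a :- con three :* (con 1ℚ :* con 0ℚ) := con 0ℚ) refl ([-3]^ m))
    (solve 1 (λ a → con 0ℚ :* con 0ℚ :+ con 1ℚ :* a := a) refl ([-3]^ m)))

  √-3^ᵣ-2+2n : ∀ n → √-3 ^ᵣ suc (suc (2 ℕ.* n)) ≡ ιᵣ ([-3]^ suc n)
  √-3^ᵣ-2+2n n = trans (cong (√-3 ^ᵣ_) (sym (ℕP.*-suc 2 n))) (√-3^ᵣ-even (suc n))

  term≡[-3]^*1/[1+] : ∀ k → term k ≡ [-3]^ k * 1/[1+ 2 ℕ.* k ]
  term≡[-3]^*1/[1+] k = sym (fromℤ*1/[1+] ((ℤ.- (+ 3)) ℤ.^ k) (2 ℕ.* k))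

  im-logSumᵣ-√-3 : ∀ n → im (logSumᵣ √-3 (suc (2 ℕ.* n))) ≡ S n
  im-logSumᵣ-√-3 zero    = refl
  im-logSumᵣ-√-3 (suc n) = begin
    im (logSumᵣ √-3 (suc (2 ℕ.* suc n)))
      ≡⟨ cong (λ k → im (logSumᵣ √-3 (suc k))) (ℕP.*-suc 2 n) ⟩
    (im (logSumᵣ √-3 (suc m)) + im (ιᵣ c₁ *ᵣ √-3 ^ᵣ suc (suc m))) + im (ιᵣ c₂ *ᵣ √-3 ^ᵣ suc (suc (suc m)))
      ≡⟨ cong₂ _+_ (cong₂ _+_ (im-logSumᵣ-√-3 n)
                              (trans (im-ιᵣ-* c₁ (√-3 ^ᵣ suc (suc m))) (cong (λ w → c₁ * im w) (√-3^ᵣ-2+2n n))))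
                   (trans (im-ιᵣ-* c₂ (√-3 ^ᵣ suc (suc (suc m)))) (cong (λ w → c₂ * im w) odd-power)) ⟩
    (S n + c₁ * 0ℚ) + c₂ * [-3]^ suc n
      ≡⟨ solve 4 (λ s a b t → (s :+ a :* con 0ℚ) :+ b :* t := s :+ t :* b) refl (S n) c₁ c₂ ([-3]^ suc n) ⟩
    S n + [-3]^ suc n * c₂
      ≡⟨ cong (λ k → S n + [-3]^ suc n * 1/[1+ k ]) (sym (ℕP.*-suc 2 n)) ⟩
    S n + [-3]^ suc n * 1/[1+ 2 ℕ.* suc n ]
      ≡⟨ cong (λ t → S n + t) (sym (term≡[-3]^*1/[1+] (suc n))) ⟩
    S (suc n) ∎
    where
    open ≡-Reasoning
    m = 2 ℕ.* n
    c₁ = 1/[1+ suc m ]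
    c₂ = 1/[1+ suc (suc m) ]
    odd-power : √-3 ^ᵣ suc (suc (suc m)) ≡ (0ℚ , [-3]^ suc n)
    odd-power = trans (cong (λ k → √-3 ^ᵣ suc k) (sym (ℕP.*-suc 2 n))) (√-3^ᵣ-odd (suc n))

module ThreeIntegral where

  open import Data.Rational using (_+_; _*_; -_; _-_; _/_; ↧ₙ_)
  open import Data.Nat.Divisibility using (_∣_; divides; _∣?_; ∣-trans; ∣1⇒≡1)
  open import Data.Nat.Primality using (Prime; prime?; euclidsLemma)
  open import Data.Sum using (inj₁; inj₂)
  open import Data.Empty using (⊥-elim)
  open import Relation.Nullary using (¬_; yes; no)
  open import Relation.Nullary.Decidable using (from-yes)
  open Fractions
  open Polynomials
  open TruncatedLogarithm using (logSum)
  open QuadraticField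

  prime-3 : Prime 3
  prime-3 = from-yes (prime? 3)

  3∤1 : ¬ 3 ∣ 1
  3∤1 3∣1 with ∣1⇒≡1 3∣1
  ... | ()

  3∤* : ∀ {m n} → ¬ 3 ∣ m → ¬ 3 ∣ n → ¬ 3 ∣ m ℕ.* n
  3∤* {m} {n} 3∤m 3∤n 3∣mn with euclidsLemma m n prime-3 3∣mn
  ... | inj₁ 3∣m = 3∤m 3∣m
  ... | inj₂ 3∣n = 3∤n 3∣n

  ∣-from-ℤ : ∀ a b (k : ℤ) → + a ℤ.* k ≡ + b → a ∣ b
  ∣-from-ℤ a b k eq = divides ℤ.∣ k ∣ (trans (cong ℤ.∣_∣ (sym eq)) (trans (ℤP.abs-* (+ a) k) (ℕP.*-comm a _)))

  record Int₃ (q : ℚ) : Set where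
    constructor int₃
    field 3∤↧ : ¬ 3 ∣ ↧ₙ q
  open Int₃ public

  Int₃-+ : ∀ p q → Int₃ p → Int₃ q → Int₃ (p + q)
  Int₃-+ p q (int₃ 3∤p) (int₃ 3∤q) = int₃ λ 3∣ → 3∤* 3∤p 3∤q
    (∣-trans 3∣ (∣-from-ℤ (↧ₙ (p + q)) (↧ₙ p ℕ.* ↧ₙ q) _ (trans (ℚP.↧-+ p q) (sym (ℤP.pos-* (↧ₙ p) (↧ₙ q))))))

  Int₃-* : ∀ p q → Int₃ p → Int₃ q → Int₃ (p * q)
  Int₃-* p q (int₃ 3∤p) (int₃ 3∤q) = int₃ λ 3∣ → 3∤* 3∤p 3∤q
    (∣-trans 3∣ (∣-from-ℤ (↧ₙ (p * q)) (↧ₙ p ℕ.* ↧ₙ q) _ (trans (ℚP.↧-* p q) (sym (ℤP.pos-* (↧ₙ p) (↧ₙ q))))))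

  Int₃-neg : ∀ p → Int₃ p → Int₃ (- p)
  Int₃-neg p (int₃ 3∤p) = int₃ λ 3∣ → 3∤p (subst (3 ∣_) (ℤP.+-injective (ℚP.↧-neg p)) 3∣)

  Int₃-- : ∀ p q → Int₃ p → Int₃ q → Int₃ (p - q)
  Int₃-- p q ip iq = Int₃-+ p (- q) ip (Int₃-neg q iq)

  Int₃-/ : ∀ i n .{{_ : NonZero n}} → ¬ 3 ∣ n → Int₃ (i / n)
  Int₃-/ i n 3∤n = int₃ λ 3∣ → 3∤n (∣-trans 3∣ (∣-from-ℤ (↧ₙ (i / n)) n _ (ℚP.↧-/ i n)))

  Int₃-fromℤ : ∀ z → Int₃ (fromℤ z)
  Int₃-fromℤ z = Int₃-/ z 1 3∤1

  Int₃-3^K*1/[1+] : ∀ K m → suc m ℕ.≤ 3 ^ K → Int₃ (fromℕ (3 ^ K) * 1/[1+ m ])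
  Int₃-3^K*1/[1+] K m m<3^K with 3 ∣? suc m
  ... | no 3∤ = Int₃-* (fromℕ (3 ^ K)) 1/[1+ m ] (Int₃-fromℤ (+ (3 ^ K))) (Int₃-/ (+ 1) (suc m) 3∤)
  Int₃-3^K*1/[1+] zero m m<1 | yes 3∣ = ⊥-elim (3∤1 (subst (3 ∣_) (ℕP.≤-antisym m<1 (ℕ.s≤s ℕ.z≤n)) 3∣))
  Int₃-3^K*1/[1+] (suc K) m m<3^K | yes (divides (suc q) eq) =
    subst Int₃ (sym cancel-3) (Int₃-3^K*1/[1+] K q (ℕP.*-cancelʳ-≤ (suc q) (3 ^ K) 3 q*3≤3^K*3))
    where
    q*3≤3^K*3 : suc q ℕ.* 3 ℕ.≤ 3 ^ K ℕ.* 3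
    q*3≤3^K*3 = subst₂ ℕ._≤_ eq (ℕP.*-comm 3 (3 ^ K)) m<3^K
    cancel-3 : fromℕ (3 ^ suc K) * 1/[1+ m ] ≡ fromℕ (3 ^ K) * 1/[1+ q ]
    cancel-3 = begin
      fromℕ (3 ^ suc K) * 1/[1+ m ]  ≡⟨ fromℤ*1/[1+] (+ (3 ^ suc K)) m ⟩
      + (3 ^ suc K) / suc m          ≡⟨ *≡*⇒/≡/ (+ (3 ^ suc K)) (+ (3 ^ K)) (suc m) (suc q) cross ⟩
      + (3 ^ K) / suc q              ≡⟨ sym (fromℤ*1/[1+] (+ (3 ^ K)) q) ⟩
      fromℕ (3 ^ K) * 1/[1+ q ]      ∎
      where
      open ≡-Reasoning
      cross : + (3 ^ suc K) ℤ.* + suc q ≡ + (3 ^ K) ℤ.* + suc m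
      cross = begin
        + (3 ^ suc K) ℤ.* + suc q    ≡⟨ sym (ℤP.pos-* (3 ^ suc K) (suc q)) ⟩
        + (3 ^ suc K ℕ.* suc q)      ≡⟨ cong +_ (solve 2 (λ x q → (con 3 :* x) :* q := x :* (q :* con 3)) refl (3 ^ K) (suc q)) ⟩
        + (3 ^ K ℕ.* (suc q ℕ.* 3))  ≡⟨ cong (λ n → + (3 ^ K ℕ.* n)) (sym eq) ⟩
        + (3 ^ K ℕ.* suc m)          ≡⟨ ℤP.pos-* (3 ^ K) (suc m) ⟩
        + (3 ^ K) ℤ.* + suc m        ∎
        where open ℕ-Solver.+-*-Solver
  Int₃-3^K*1/[1+] (suc K) m m<3^K | yes (divides zero ())

  IntP : Poly → Set
  IntP p = ∀ j → Int₃ (coeff p j)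

  IntP-≈ : ∀ {p q} → p ≈ q → IntP p → IntP q
  IntP-≈ e ip j = subst Int₃ (at e j) (ip j)

  IntP-⊕ : ∀ p q → IntP p → IntP q → IntP (p ⊕ q)
  IntP-⊕ p q ip iq j = subst Int₃ (sym (coeff-⊕ p q j)) (Int₃-+ _ _ (ip j) (iq j))

  IntP-· : ∀ c p → Int₃ c → IntP p → IntP (c · p)
  IntP-· c p ic ip j = subst Int₃ (sym (coeff-· c p j)) (Int₃-* _ _ ic (ip j))

  IntP-⊖ : ∀ p q → IntP p → IntP q → IntP (p ⊖ q)
  IntP-⊖ p q ip iq = IntP-⊕ p (⊖ q) ip (IntP-· (- 1ℚ) q (Int₃-fromℤ (ℤ.- (+ 1))) iq)

  IntP-shift : ∀ p → IntP p → IntP (shift p)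
  IntP-shift p ip zero    = Int₃-fromℤ (+ 0)
  IntP-shift p ip (suc j) = ip j

  IntP-⊗ : ∀ p q → IntP p → IntP q → IntP (p ⊗ q)
  IntP-⊗ []      q ip iq j = Int₃-fromℤ (+ 0)
  IntP-⊗ (a ∷ p) q ip iq   = IntP-⊕ (a · q) (shift (p ⊗ q)) (IntP-· a q (ip 0) iq)
                               (IntP-shift (p ⊗ q) (IntP-⊗ p q (λ j → ip (suc j)) iq))

  IntP-one : IntP one
  IntP-one zero    = Int₃-fromℤ (+ 1)
  IntP-one (suc j) = Int₃-fromℤ (+ 0)

  IntP-^ₚ : ∀ p n → IntP p → IntP (p ^ₚ n)
  IntP-^ₚ p zero    ip = IntP-one
  IntP-^ₚ p (suc n) ip = IntP-⊗ p (p ^ₚ n) ip (IntP-^ₚ p n ip)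

  IntP-drop : ∀ m p → IntP p → IntP (drop m p)
  IntP-drop zero    p       ip = ip
  IntP-drop (suc m) []      ip = ip
  IntP-drop (suc m) (a ∷ p) ip = IntP-drop m p (λ j → ip (suc j))

  IntP-3^K·logSum : ∀ K p N → IntP p → N ℕ.≤ 3 ^ K → IntP (fromℕ (3 ^ K) · logSum p N)
  IntP-3^K·logSum K p zero    ip N≤3^K j = Int₃-fromℤ (+ 0)
  IntP-3^K·logSum K p (suc N) ip N<3^K   = IntP-≈ (≈-sym distribute)
    (IntP-⊕ (κ · logSum p N) ((κ * 1/[1+ N ]) · p ^ₚ suc N)
    (IntP-3^K·logSum K p N ip (ℕP.<⇒≤ N<3^K))
    (IntP-· (κ * 1/[1+ N ]) (p ^ₚ suc N) (Int₃-3^K*1/[1+] K N N<3^K) (IntP-^ₚ p (suc N) ip)))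
    where
    κ = fromℕ (3 ^ K)
    distribute : κ · (logSum p N ⊕ 1/[1+ N ] · p ^ₚ suc N) ≈ κ · logSum p N ⊕ (κ * 1/[1+ N ]) · p ^ₚ suc N
    distribute = ≈-trans (·-distribˡ κ (logSum p N) _) (⊕-congʳ (κ · logSum p N) (·-assoc κ 1/[1+ N ] (p ^ₚ suc N)))

  IntR : ℚ[√-3] → Set
  IntR x = Int₃ (re x) × Int₃ (im x)

  IntR-+ : ∀ x y → IntR x → IntR y → IntR (x +ᵣ y)
  IntR-+ (a , b) (c , d) (ia , ib) (ic , id) = Int₃-+ a c ia ic , Int₃-+ b d ib id

  IntR-* : ∀ x y → IntR x → IntR y → IntR (x *ᵣ y)
  IntR-* (a , b) (c , d) (ia , ib) (ic , id) =
    Int₃-- (a * c) (three * (b * d)) (Int₃-* a c ia ic) (Int₃-* three (b * d) (Int₃-fromℤ (+ 3)) (Int₃-* b d ib id)) ,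
    Int₃-+ (a * d) (b * c) (Int₃-* a d ia id) (Int₃-* b c ib ic)

  IntR-ev : ∀ p z → IntP p → IntR z → IntR (ev p z)
  IntR-ev []      z ip iz = Int₃-fromℤ (+ 0) , Int₃-fromℤ (+ 0)
  IntR-ev (a ∷ p) z ip iz = IntR-+ (ιᵣ a) (z *ᵣ ev p z) (ip 0 , Int₃-fromℤ (+ 0))
    (IntR-* z (ev p z) iz (IntR-ev p z (λ j → ip (suc j)) iz))

module ThreeAdicDivisibility where

  open import Data.Rational using (0ℚ; _+_; _*_; -_; Positive)
  open Fractions
  open Polynomials
  open TruncatedLogarithm
  open LogarithmOfCube
  open QuadraticField
  open ThreeIntegral
  open ℚ-Solver.+-*-Solver

  record [3^_]∣_ (e : ℕ) (x : ℚ) : Set where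
    constructor divides₃
    field
      quotient    : ℚ
      integral    : Int₃ quotient
      factorised  : x ≡ fromℕ (3 ^ e) * quotient

  fromℕ-3^-+ : ∀ a b → fromℕ (3 ^ (a ℕ.+ b)) ≡ fromℕ (3 ^ a) * fromℕ (3 ^ b)
  fromℕ-3^-+ a b = trans (cong fromℕ (ℕP.^-distribˡ-+-* 3 a b)) (fromℕ-* (3 ^ a) (3 ^ b))

  3^-positive : ∀ b → Positive (fromℕ (3 ^ b))
  3^-positive b = ℚP.normalize-pos (3 ^ b) 1 {{_}} {{ℕP.m^n≢0 3 b}}

  Int₃⇒[3^0]∣ : ∀ {x} → Int₃ x → [3^ 0 ]∣ x
  Int₃⇒[3^0]∣ {x} ix = divides₃ x ix (sym (ℚP.*-identityˡ x))

  [3^]∣-* : ∀ {a b x y} → [3^ a ]∣ x → [3^ b ]∣ y → [3^ a ℕ.+ b ]∣ (x * y)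
  [3^]∣-* {a} {b} (divides₃ d id refl) (divides₃ d' id' refl) = divides₃ (d * d') (Int₃-* d d' id id') (begin
    (fromℕ (3 ^ a) * d) * (fromℕ (3 ^ b) * d')     ≡⟨ solve 4 (λ p d q d' → (p :* d) :* (q :* d') := (p :* q) :* (d :* d')) refl
                                                        (fromℕ (3 ^ a)) d (fromℕ (3 ^ b)) d' ⟩
    (fromℕ (3 ^ a) * fromℕ (3 ^ b)) * (d * d')     ≡⟨ cong (_* (d * d')) (sym (fromℕ-3^-+ a b)) ⟩
    fromℕ (3 ^ (a ℕ.+ b)) * (d * d')               ∎)
    where open ≡-Reasoning

  [3^]∣-cancel : ∀ a b {x} → [3^ a ℕ.+ b ]∣ (fromℕ (3 ^ b) * x) → [3^ a ]∣ x
  [3^]∣-cancel a b {x} (divides₃ d id eq) = divides₃ d id (cancel (begin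
    fromℕ (3 ^ b) * x                          ≡⟨ eq ⟩
    fromℕ (3 ^ (a ℕ.+ b)) * d                   ≡⟨ cong (_* d) (trans (fromℕ-3^-+ a b) (ℚP.*-comm (fromℕ (3 ^ a)) _)) ⟩
    (fromℕ (3 ^ b) * fromℕ (3 ^ a)) * d        ≡⟨ ℚP.*-assoc (fromℕ (3 ^ b)) _ d ⟩
    fromℕ (3 ^ b) * (fromℕ (3 ^ a) * d)        ∎))
    where
    open ≡-Reasoning
    instance _ = 3^-positive b
    cancel : ∀ {p q} → fromℕ (3 ^ b) * p ≡ fromℕ (3 ^ b) * q → p ≡ q
    cancel e = ℚP.≤-antisym (ℚP.*-cancelˡ-≤-pos (fromℕ (3 ^ b)) (ℚP.≤-reflexive e))
                            (ℚP.*-cancelˡ-≤-pos (fromℕ (3 ^ b)) (ℚP.≤-reflexive (sym e)))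

  [3^]∣[-3]^ : ∀ m → [3^ m ]∣ [-3]^ m
  [3^]∣[-3]^ zero    = Int₃⇒[3^0]∣ (Int₃-fromℤ (+ 1))
  [3^]∣[-3]^ (suc m) = subst ([3^ suc m ]∣_) (sym (fromℤ-* (ℤ.- (+ 3)) ((ℤ.- (+ 3)) ℤ.^ m)))
    ([3^]∣-* (divides₃ (fromℤ (ℤ.- (+ 1))) (Int₃-fromℤ (ℤ.- (+ 1))) refl) ([3^]∣[-3]^ m))

  IntP-3^K·E : ∀ K N → N ℕ.≤ 3 ^ K → IntP (fromℕ (3 ^ K) · E N)
  IntP-3^K·E K N N≤3^K = IntP-≈ (≈-sym rearrange) (IntP-⊖ (three · (κ · logSum X N)) (κ · logSum g N)
    (IntP-· three (κ · logSum X N) (Int₃-fromℤ (+ 3)) (IntP-3^K·logSum K X N IntP-X N≤3^K))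
    (IntP-3^K·logSum K g N IntP-g N≤3^K))
    where
    κ = fromℕ (3 ^ K)
    rearrange : κ · E N ≈ three · (κ · logSum X N) ⊖ κ · logSum g N
    rearrange = ≈-trans (·-distrib-⊖ κ (three · logSum X N) (logSum g N)) (⊖-cong (·-comm κ three (logSum X N)) ≈-refl)
    IntP-X : IntP X
    IntP-X = IntP-shift one IntP-one
    IntP-g : IntP g
    IntP-g = IntP-shift g/X λ { 0 → Int₃-fromℤ (+ 3) ; 1 → Int₃-fromℤ (ℤ.- (+ 3)) ; 2 → Int₃-fromℤ (+ 1)
                            ; (suc (suc (suc j))) → Int₃-fromℤ (+ 0) }

  im-ev-E : ∀ n → im (ev (E (suc (2 ℕ.* n))) √-3) ≡ three * S n
  im-ev-E n = begin
    im (ev (three · logSum X N ⊖ logSum g N) √-3)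
      ≡⟨ cong im (ev-⊕ (three · logSum X N) (⊖ logSum g N) √-3) ⟩
    im (ev (three · logSum X N) √-3) + im (ev (⊖ logSum g N) √-3)
      ≡⟨ cong₂ _+_ (trans (cong im (ev-· three (logSum X N) √-3)) (im-ιᵣ-* three (ev (logSum X N) √-3)))
                   (trans (cong im (ev-· (- 1ℚ) (logSum g N) √-3)) (im-ιᵣ-* (- 1ℚ) (ev (logSum g N) √-3))) ⟩
    three * im (ev (logSum X N) √-3) + - 1ℚ * im (ev (logSum g N) √-3)
      ≡⟨ cong₂ (λ x y → three * x + - 1ℚ * y)
           (trans (cong im (ev-logSum X N √-3)) (im-logSumᵣ-√-3 n))
           (trans (cong im (ev-logSum g N √-3)) (im-logSumᵣ-real (ev g √-3) N refl)) ⟩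
    three * S n + - 1ℚ * 0ℚ
      ≡⟨ solve 1 (λ s → con three :* s :+ :- con 1ℚ :* con 0ℚ := con three :* s) refl (S n) ⟩
    three * S n ∎
    where
    open ≡-Reasoning
    N = suc (2 ℕ.* n)

  S-divisible : ∀ e K → suc (2 ℕ.* (e ℕ.+ K)) ℕ.≤ 3 ^ K → [3^ e ]∣ S (e ℕ.+ K)
  S-divisible e K N≤3^K = [3^]∣-cancel e (suc K) (subst₂ [3^_]∣_ exponent (trans (sym factorised) via-S) divisible)
    where
    n = e ℕ.+ K
    N = suc (2 ℕ.* n)
    κ = fromℕ (3 ^ K)
    F = κ · E N
    w = ev (drop (suc N) F) √-3
    w-integral : IntR w
    w-integral = IntR-ev (drop (suc N) F) √-3 (IntP-drop (suc N) F (IntP-3^K·E K N N≤3^K))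
                         (Int₃-fromℤ (+ 0) , Int₃-fromℤ (+ 1))
    via-S : im (ev F √-3) ≡ fromℕ (3 ^ suc K) * S n
    via-S = begin
      im (ev F √-3)             ≡⟨ trans (cong im (ev-· κ (E N) √-3)) (im-ιᵣ-* κ (ev (E N) √-3)) ⟩
      κ * im (ev (E N) √-3)     ≡⟨ cong (κ *_) (im-ev-E n) ⟩
      κ * (three * S n)         ≡⟨ solve 3 (λ k t s → k :* (t :* s) := (t :* k) :* s) refl κ three (S n) ⟩
      (three * κ) * S n         ≡⟨ cong (_* S n) (sym (fromℕ-* 3 (3 ^ K))) ⟩
      fromℕ (3 ^ suc K) * S n   ∎
      where open ≡-Reasoning
    factorised : im (ev F √-3) ≡ [-3]^ suc n * im w
    factorised = begin
      im (ev F √-3)               ≡⟨ cong im (ev-≈[]-drop (suc N) F √-3 (≈[]-· κ (E-≈[] N))) ⟩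
      im (√-3 ^ᵣ suc N *ᵣ w)      ≡⟨ cong (λ z → im (z *ᵣ w)) (trans (cong (√-3 ^ᵣ_) (sym (ℕP.*-suc 2 n))) (√-3^ᵣ-even (suc n))) ⟩
      im (ιᵣ ([-3]^ suc n) *ᵣ w)  ≡⟨ im-ιᵣ-* ([-3]^ suc n) w ⟩
      [-3]^ suc n * im w          ∎
      where open ≡-Reasoning
    divisible : [3^ suc n ℕ.+ 0 ]∣ ([-3]^ suc n * im w)
    divisible = [3^]∣-* ([3^]∣[-3]^ (suc n)) (Int₃⇒[3^0]∣ (proj₂ w-integral))
    exponent : suc n ℕ.+ 0 ≡ e ℕ.+ suc K
    exponent = trans (ℕP.+-identityʳ (suc n)) (sym (ℕP.+-suc e K))

module ThreeAdicAbsoluteValue where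

  open import Data.Rational using (0ℚ; _/_; ↥_; ↧ₙ_; mkℚ)
  open import Data.Integer using (-[1+_])
  open import Data.Nat.DivMod using (m/n*n≡m; m/n<m)
  open import Data.Nat.Divisibility
    using (_∣_; divides; ∣-trans; m∣m*n; *-cancelˡ-∣; *-monoʳ-∣; 1∣_; m%n≡0⇒n∣m; n∣m⇒m%n≡0)
  open import Data.Nat.Primality using (euclidsLemma)
  import Data.Nat.Coprimality as Coprime
  open import Data.Sum using (inj₁; inj₂)
  open import Data.Empty using (⊥-elim)
  open import Relation.Nullary using (¬_)
  open Fractions
  open ThreeIntegral
  open ThreeAdicDivisibility
  open [3^_]∣_ using (quotient)

  v₃-go-≡0 : ∀ f m → ¬ 3 ∣ suc m → v₃-go (suc f) (suc m) ≡ 0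
  v₃-go-≡0 f m 3∤ with suc m ℕ.% 3 in rem
  ... | zero  = ⊥-elim (3∤ (m%n≡0⇒n∣m (suc m) 3 rem))
  ... | suc _ = refl

  3^∣⇒≤v₃-go : ∀ e f m → suc m ℕ.≤ f → 3 ^ e ∣ suc m → e ℕ.≤ v₃-go f (suc m)
  3^∣⇒≤v₃-go zero    f       m _     _       = ℕ.z≤n
  3^∣⇒≤v₃-go (suc e) zero    m ()    _
  3^∣⇒≤v₃-go (suc e) (suc f) m sm≤sf 3^e+1∣ with suc m ℕ.% 3 in rem
  ... | suc _ = ⊥-elim (ℕP.1+n≢0 (trans (sym rem) (n∣m⇒m%n≡0 (suc m) 3 3∣)))
    where 3∣ = ∣-trans (m∣m*n (3 ^ e)) 3^e+1∣
  ... | zero with suc m ℕ./ 3 | m/n*n≡m (m%n≡0⇒n∣m (suc m) 3 rem) | m/n<m (suc m) 3 (ℕ.s≤s (ℕ.s≤s ℕ.z≤n))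
  ...   | zero  | 0≡1+m  | _     = ⊥-elim (ℕP.1+n≢0 (sym 0≡1+m))
  ...   | suc q | q*3≡1+m | q<1+m = ℕ.s≤s (3^∣⇒≤v₃-go e f q (ℕP.≤-trans (ℕP.≤-pred q<1+m) (ℕP.≤-pred sm≤sf)) 3^e∣q)
    where
    3^e∣q : 3 ^ e ∣ suc q
    3^e∣q = *-cancelˡ-∣ 3 (subst (3 ^ suc e ∣_) (trans (sym q*3≡1+m) (ℕP.*-comm (suc q) 3)) 3^e+1∣)

  3^∣-cancelʳ : ∀ e {a b} → ¬ 3 ∣ b → 3 ^ e ∣ a ℕ.* b → 3 ^ e ∣ a
  3^∣-cancelʳ zero    {a}     3∤b _ = 1∣ a
  3^∣-cancelʳ (suc e) {a} {b} 3∤b 3^e+1∣ab with euclidsLemma a b prime-3 (∣-trans (m∣m*n (3 ^ e)) 3^e+1∣ab)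
  ... | inj₂ 3∣b = ⊥-elim (3∤b 3∣b)
  ... | inj₁ (divides q refl) = subst (3 ^ suc e ∣_) (ℕP.*-comm 3 q) (*-monoʳ-∣ 3 (3^∣-cancelʳ e {q} 3∤b
        (*-cancelˡ-∣ 3 (subst (3 ℕ.* 3 ^ e ∣_) (trans (cong (ℕ._* b) (ℕP.*-comm q 3)) (ℕP.*-assoc 3 q b)) 3^e+1∣ab))))

  [3^]∣-cross : ∀ {e s} (3^e∣s : [3^ e ]∣ s) → let d = quotient 3^e∣s in
                ℤ.∣ ↥ s ∣ ℕ.* ↧ₙ d ≡ 3 ^ e ℕ.* (ℤ.∣ ↥ d ∣ ℕ.* ↧ₙ s)
  [3^]∣-cross {e} {s@(mkℚ sn _ _)} (divides₃ d@(mkℚ dn _ _) _ eq) = begin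
    ℤ.∣ sn ∣ ℕ.* ↧ₙ d                          ≡⟨ cong (ℤ.∣ sn ∣ ℕ.*_) (sym (ℕP.*-identityˡ (↧ₙ d))) ⟩
    ℤ.∣ sn ∣ ℕ.* (1 ℕ.* ↧ₙ d)                  ≡⟨ sym (ℤP.abs-* sn (+ (1 ℕ.* ↧ₙ d))) ⟩
    ℤ.∣ sn ℤ.* + (1 ℕ.* ↧ₙ d) ∣                ≡⟨ cong ℤ.∣_∣ cross ⟩
    ℤ.∣ (+ (3 ^ e) ℤ.* dn) ℤ.* + ↧ₙ s ∣        ≡⟨ trans (ℤP.abs-* (+ (3 ^ e) ℤ.* dn) (+ ↧ₙ s)) (cong (ℕ._* ↧ₙ s) (ℤP.abs-* (+ (3 ^ e)) dn)) ⟩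
    (3 ^ e ℕ.* ℤ.∣ dn ∣) ℕ.* ↧ₙ s              ≡⟨ ℕP.*-assoc (3 ^ e) ℤ.∣ dn ∣ (↧ₙ s) ⟩
    3 ^ e ℕ.* (ℤ.∣ dn ∣ ℕ.* ↧ₙ s)              ∎
    where
    open ≡-Reasoning
    cross : sn ℤ.* + (1 ℕ.* ↧ₙ d) ≡ (+ (3 ^ e) ℤ.* dn) ℤ.* + ↧ₙ s
    cross with ℚᵘP.≃-trans (ℚᵘP.≃-reflexive (cong ℚ.toℚᵘ eq))
                 (ℚᵘP.≃-trans (ℚP.toℚᵘ-homo-* (fromℕ (3 ^ e)) d) (ℚᵘP.*-congʳ (toℚᵘ-/ (+ (3 ^ e)) 1)))
    ... | ℚᵘ.*≡* x = x

  [3^]∣⇒3∤↧ : ∀ {e s} → [3^ e ]∣ s → ¬ 3 ∣ ↧ₙ s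
  [3^]∣⇒3∤↧ {e} {s@(mkℚ _ _ coprime)} 3^e∣s@(divides₃ d (int₃ 3∤↧d) _) 3∣↧s =
    3∤↧d (∣-trans 3∣↧s (Coprime.coprime-divisor (Coprime.sym (Coprime.recompute coprime))
      (divides (3 ^ e ℕ.* ℤ.∣ ↥ d ∣) (trans ([3^]∣-cross 3^e∣s) (sym (ℕP.*-assoc (3 ^ e) _ _))))))

  [3^]∣⇒3^∣↥ : ∀ {e s} → [3^ e ]∣ s → 3 ^ e ∣ ℤ.∣ ↥ s ∣
  [3^]∣⇒3^∣↥ {e} {s} 3^e∣s@(divides₃ d (int₃ 3∤↧d) _) = 3^∣-cancelʳ e 3∤↧d
    (divides (ℤ.∣ ↥ d ∣ ℕ.* ↧ₙ s) (trans ([3^]∣-cross 3^e∣s) (ℕP.*-comm (3 ^ e) _)))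

  1/-antimono-≤ : ∀ m n .{{_ : NonZero m}} .{{_ : NonZero n}} → m ℕ.≤ n → + 1 / n ℚ.≤ + 1 / m
  1/-antimono-≤ m@(suc _) n@(suc _) m≤n = ℚP.toℚᵘ-cancel-≤
    (ℚᵘP.≤-respˡ-≃ (ℚᵘP.≃-sym (toℚᵘ-/ (+ 1) n)) (ℚᵘP.≤-respʳ-≃ (ℚᵘP.≃-sym (toℚᵘ-/ (+ 1) m))
      (ℚᵘ.*≤* (subst₂ ℤ._≤_ (sym (ℤP.*-identityˡ (+ m))) (sym (ℤP.*-identityˡ (+ n))) (ℤ.+≤+ m≤n)))))

  ∣∣₃-formula-≤ : ∀ {e s} → [3^ e ]∣ s → ∀ k → ℤ.∣ ↥ s ∣ ≡ suc k →
    ((+ (3 ^ v₃ℕ (↧ₙ s))) / 3 ^ v₃ℕ (suc k)) {{ℕP.m^n≢0 3 (v₃ℕ (suc k))}} ℚ.≤ ((+ 1) / 3 ^ e) {{ℕP.m^n≢0 3 e}}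
  ∣∣₃-formula-≤ {e} {s@(mkℚ _ d _)} 3^e∣s k ∣↥s∣≡1+k =
    subst (λ t → ((+ (3 ^ t)) / 3 ^ v) {{ℕP.m^n≢0 3 v}} ℚ.≤ ((+ 1) / 3 ^ e) {{ℕP.m^n≢0 3 e}}) (sym v₃↧s≡0)
      (1/-antimono-≤ (3 ^ e) (3 ^ v) {{ℕP.m^n≢0 3 e}} {{ℕP.m^n≢0 3 v}} (ℕP.^-monoʳ-≤ 3 e≤v))
    where
    v = v₃ℕ (suc k)
    v₃↧s≡0 : v₃ℕ (suc d) ≡ 0
    v₃↧s≡0 = v₃-go-≡0 d d ([3^]∣⇒3∤↧ 3^e∣s)
    e≤v : e ℕ.≤ v
    e≤v = 3^∣⇒≤v₃-go e (suc k) k ℕP.≤-refl (subst (3 ^ e ∣_) ∣↥s∣≡1+k ([3^]∣⇒3^∣↥ 3^e∣s))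

  [3^]∣⇒∣∣₃≤ : ∀ {e s} → [3^ e ]∣ s → ∣ s ∣₃ ℚ.≤ ((+ 1) / 3 ^ e) {{ℕP.m^n≢0 3 e}}
  [3^]∣⇒∣∣₃≤ {e} {mkℚ (+ zero)   _ _} _     = ℚP.nonNegative⁻¹ _ {{ℚP.normalize-nonNeg 1 (3 ^ e) {{ℕP.m^n≢0 3 e}}}}
  [3^]∣⇒∣∣₃≤ {e} {mkℚ (+ suc k)  _ _} 3^e∣s = ∣∣₃-formula-≤ 3^e∣s k refl
  [3^]∣⇒∣∣₃≤ {e} {mkℚ -[1+ k ]   _ _} 3^e∣s = ∣∣₃-formula-≤ 3^e∣s k refl

  ↧<⇒1/< : ∀ m .{{_ : NonZero m}} ε → 0ℚ ℚ.< ε → ↧ₙ ε ℕ.< m → + 1 / m ℚ.< ε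
  ↧<⇒1/< m@(suc _) (mkℚ (+ suc a) _ _) _ ↧ε<m = ℚP.toℚᵘ-cancel-<
    (ℚᵘP.<-respˡ-≃ (ℚᵘP.≃-sym (toℚᵘ-/ (+ 1) m)) (ℚᵘ.*<* (subst₂ ℤ._<_ (sym (ℤP.*-identityˡ _)) (ℤP.pos-* (suc a) m)
      (ℤ.+<+ (ℕP.<-≤-trans ↧ε<m (ℕP.m≤n*m m (suc a)))))))
  ↧<⇒1/< m (mkℚ (+ zero)  _ _) (ℚ.*<* (ℤ.+<+ ()))
  ↧<⇒1/< m (mkℚ -[1+ _ ]  _ _) (ℚ.*<* ())

module ExponentialBounds where

  open import Data.Nat using (_+_; _*_; _≤_; _<_; z≤n; s≤s)
  open import Data.Nat.Properties
  open ℕ-Solver.+-*-Solver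

  n<3^n : ∀ n → n < 3 ^ n
  n<3^n zero    = s≤s z≤n
  n<3^n (suc n) = ≤-<-trans (n<3^n n) (^-monoʳ-< 3 (s≤s (s≤s z≤n)) (n<1+n n))

  4n≤1+3^n : ∀ n → 4 * n ≤ suc (3 ^ n)
  4n≤1+3^n zero          = z≤n
  4n≤1+3^n (suc zero)    = ≤-refl
  4n≤1+3^n (suc (suc n)) = begin
    4 * suc (suc n)            ≡⟨ *-suc 4 (suc n) ⟩
    4 + 4 * suc n              ≤⟨ +-monoʳ-≤ 4 (4n≤1+3^n (suc n)) ⟩
    4 + suc (3 ^ suc n)        ≤⟨ +-monoˡ-≤ (suc (3 ^ suc n)) (≤-trans 4≤6 (*-monoʳ-≤ 2 (*-monoʳ-≤ 3 (m^n>0 3 n)))) ⟩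
    2 * 3 ^ suc n + suc (3 ^ suc n) ≡⟨ solve 1 (λ x → con 2 :* x :+ (con 1 :+ x) := con 1 :+ con 3 :* x) refl (3 ^ suc n) ⟩
    suc (3 ^ suc (suc n))      ∎
    where
    open ≤-Reasoning
    4≤6 : 4 ≤ 6
    4≤6 = s≤s (s≤s (s≤s (s≤s z≤n)))

  1+2[e+K]≤3^K : ∀ e K → e < K → suc (2 * (e + K)) ≤ 3 ^ K
  1+2[e+K]≤3^K e K e<K = ≤-pred (begin
    suc (suc (2 * (e + K)))    ≡⟨ solve 2 (λ e k → con 2 :+ con 2 :* (e :+ k) := con 2 :* (con 1 :+ e) :+ con 2 :* k) refl e K ⟩
    2 * suc e + 2 * K          ≤⟨ +-monoˡ-≤ (2 * K) (*-monoʳ-≤ 2 e<K) ⟩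
    2 * K + 2 * K              ≡⟨ solve 1 (λ k → con 2 :* k :+ con 2 :* k := con 4 :* k) refl K ⟩
    4 * K                      ≤⟨ 4n≤1+3^n K ⟩
    suc (3 ^ K)                ∎)
    where open ≤-Reasoning

open import Data.Nat.Properties using (m≤n⇒∃[o]m+o≡n)
open import Data.Rational using (_/_)
open ThreeAdicDivisibility using (S-divisible)
open ThreeAdicAbsoluteValue using ([3^]∣⇒∣∣₃≤; ↧<⇒1/<)
open ExponentialBounds using (n<3^n; 1+2[e+K]≤3^K)

lemma4p2 : ConvergesTo₃ S 0ℚ
lemma4p2 ε 0<ε = t ℕ.+ suc t , tail-small
  where
  t = ℚ.↧ₙ ε
  tail-small : ∀ n → n ℕ.≥ t ℕ.+ suc t → ∣ S n ℚ.- 0ℚ ∣₃ ℚ.< ε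
  tail-small n n≥N with m≤n⇒∃[o]m+o≡n n≥N
  ... | j , refl = begin-strict
    ∣ S (t ℕ.+ suc t ℕ.+ j) ℚ.- 0ℚ ∣₃  ≡⟨ cong ∣_∣₃ (trans (ℚP.+-identityʳ _) (cong S (ℕP.+-assoc t (suc t) j))) ⟩
    ∣ S (t ℕ.+ K) ∣₃                   ≤⟨ [3^]∣⇒∣∣₃≤ (S-divisible t K (1+2[e+K]≤3^K t K (ℕ.s≤s (ℕP.m≤m+n t j)))) ⟩
    + 1 / 3 ^ t                       <⟨ ↧<⇒1/< (3 ^ t) ε 0<ε (n<3^n t) ⟩
    ε                                 ∎
    where
    open ℚP.≤-Reasoning
    instance _ = ℕP.m^n≢0 3 t
    K = suc t ℕ.+ j
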